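{- Let $S$, $\Pi_1$, $U$, $sw$, $U_T$, $\mathbf{W}$, $\mathcal{P}$, $I$ and $M(S)$ be as in the context, and suppose that $|\Pi_1|$ is odd and $|\Pi_1|\in\{1,\,n-2,\,n-1\}$. Let $odd$ denote the set of odd integers in $\{1,\dots,n\}$. Then the nontrivial orbits of $F_2^n$ under $\mathbf{W}$ are: <ul> <li>$U_{\{i,n+1-i\}}$ for $1\le i\le\lceil n/2\rceil$, if $|\Pi_1|=1$;</li> <li>$U_{odd}$ and $U_{\{2j\}}$ for $1\le j\le (n-1)/2$, if $|\Pi_1|=n-2$;</li> <li>$U_{\{2i-1,2i\}}$ for $1\le i\le\lceil n/2\rceil$, if $|\Pi_1|=n-1$.</li> </ul> (Some listed sets may coincide.) In particular, the number of orbits (including the trivial one) is $$|\mathcal{P}|=\begin{cases}\lceil (n+2)/2\rceil, & \text{if } |\Pi_1|=1;\\ (n+3)/2, & \text{if } |\Pi_1|=n-2;\\ (n+2)/2, & \text{if } |\Pi_1|=n-1.\end{cases}$$ Moreover $M(S)\le 2$, and $M(S)=1$ if and only if: <ul> <li>if $|\Pi_1|=1$: $\{i,n+1-i\}\cap I\neq\emptyset$ for all $1\le i\le\lceil n/2\rceil$;</li> <li>if $|\Pi_1|=n-2$: $odd\cap I\neq\emptyset$, and $2j\in I$ for all $1\le j\le\lfloor n/2\rfloor$;</li> <li>if $|\Pi_1|=n-1$: $\{2i-1,2i\}\cap I\ne\emptyset$ for all $1\le i\le\lceil n/2\rceil$.</li> </ul>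
   Context: $S$ is a finite simple connected graph with vertex set $\{s_1,\dots,s_n\}$, $n\ge 2$, and edge set $R$, such that $s_1,\dots,s_{n-1}$ is an induced path. The neighbours of $s_n$ are $s_{j_1},\dots,s_{j_m}$ with $1\le j_1<\dots<j_m\le n-1$. Vectors in $F_2^n$ have coordinates indexed by the vertices; $\widetilde{s}$ is the characteristic vector of vertex $s$. The flipping move of vertex $s$ is $\mathbf{s}\in\mathrm{Mat}_n(F_2)$ with $\mathbf{s}_{ab}=1$ if $a=b$, or if $b=s$ and $ab\in R$, and $0$ otherwise. $\mathbf{W}=\langle\mathbf{s_1},\dots,\mathbf{s_n}\rangle\le \mathrm{GL}_n(F_2)$ is the flipping group, acting on $F_2^n$ by left multiplication. $\mathcal{P}$ is its set of orbits (equal to the equivalence classes of the lit-only flipping puzzle); $\{0\}$ is the trivial orbit. Set $\overline{1}=\widetilde{s}_1$ and $\overline{i+1}=\mathbf{s_i}\cdots\mathbf{s_1}\overline{1}$ for $1\le i\le n-1$. $\Pi=\{\overline1,\dots,\overline n\}$, $\Pi_0=\{\overline i\in\Pi:\langle\overline i,\widetilde s_n\rangle=0\}$ (dot product over $F_2$), $\Pi_1=\Pi\setminus\Pi_0$, and $[\overline i]=\{\overline1,\dots,\overline i\}$ with $[\overline0]=\emptyset$. $U=\mathrm{span}(\Pi)$, which equals $F_2^n$ when $|\Pi_1|$ is odd. In that case $\Delta=\Pi$ is a basis of $F_2^n$. $\Delta(u)$ is the subset of $\Delta$ summing to $u$, $sw(u)=|\Delta(u)|$, and $V_T=\{u\in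 V: sw(u)\in T\}$ for $V\subseteq F_2^n$, $T\subseteq\{0,\dots,n\}$. $w(u)$ is the Hamming weight, $w(O)=\min_{u\in O}w(u)$, and $M(S)=\max_{O\in\mathcal P}w(O)$. $I=\{i\in[n]: |[\overline{i}]\cap\Pi_1| \text{ even, or } i=n, \text{ or } |[\overline{n-i}]\cap\Pi_1| \text{ odd}\}$, where $[n]=\{1,\dots,n\}$. -}

module Defs where

open import Data.Nat using (ℕ; zero; suc; _+_; _*_; _∸_; _≤_; _<_; _%_; _≡ᵇ_)
open import Data.Nat.Properties using (m<n⇒m<1+n)
open import Data.Bool using (Bool; true; false; _∧_; _∨_; _xor_; if_then_else_)
open import Data.Fin using (Fin; zero; suc; toℕ; fromℕ; fromℕ<; _≟_)
open import Data.Fin.Properties using (toℕ<n)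
open import Data.Vec using (Vec; []; _∷_; lookup; tabulate; replicate)
open import Data.List using (List; foldr; map; filter; length)
open import Data.List.Base using (allFin)
open import Data.Product using (Σ; ∃; _×_; _,_)
open import Data.Sum using (_⊎_)
open import Relation.Binary.PropositionalEquality using (_≡_; _≢_)
open import Relation.Nullary.Decidable using (⌊_⌋)

Even : ℕ → Set
Even k = k % 2 ≡ 0

Odd : ℕ → Set
Odd k = k % 2 ≡ 1

-- Graphs on the vertex set Fin n, given by a Boolean adjacency matrix.
-- Vertex s_i of the paper is the element of Fin n with toℕ = i - 1.

Adj : ℕ → Set
Adj n = Fin n → Fin n → Bool

IsSimple : ∀ {n} → Adj n → Set
IsSimple {n} adj = (∀ a b → adj a b ≡ adj b a) × (∀ a → adj a a ≡ false)

data Walk {n} (adj : Adj n) : Fin n → Fin n → Set where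
  here : ∀ {a} → Walk adj a a
  step : ∀ {a b c} → adj a b ≡ true → Walk adj b c → Walk adj a c

IsConnected : ∀ {n} → Adj n → Set
IsConnected {n} adj = ∀ (a b : Fin n) → Walk adj a b

-- s_1, ..., s_{n-1} is an induced path (here n = suc m, s_n = fromℕ m):
-- for vertices of index < m, adjacency holds iff the indices differ by one.
InducedPathPrefix : ∀ {m} → Adj (suc m) → Set
InducedPathPrefix {m} adj =
  ∀ (a b : Fin (suc m)) → toℕ a < m → toℕ b < m →
    (adj a b ≡ true → (suc (toℕ a) ≡ toℕ b ⊎ suc (toℕ b) ≡ toℕ a)) ×
    ((suc (toℕ a) ≡ toℕ b ⊎ suc (toℕ b) ≡ toℕ a) → adj a b ≡ true)

Mat : ℕ → Set
Mat n = Fin n → Fin n → Bool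

F2 : ℕ → Set
F2 n = Vec Bool n

zeroV : ∀ {n} → F2 n
zeroV = replicate _ false

_⊕_ : ∀ {n} → F2 n → F2 n → F2 n
u ⊕ v = tabulate (λ a → lookup u a xor lookup v a)

sumF2 : List Bool → Bool
sumF2 = foldr _xor_ false

_·_ : ∀ {n} → Mat n → F2 n → F2 n
_·_ {n} M x = tabulate (λ a → sumF2 (map (λ b → M a b ∧ lookup x b) (allFin n)))

charV : ∀ {n} → Fin n → F2 n
charV s = tabulate (λ a → ⌊ a ≟ s ⌋)

⟨_,_⟩ : ∀ {n} → F2 n → F2 n → Bool
⟨_,_⟩ {n} u v = sumF2 (map (λ a → lookup u a ∧ lookup v a) (allFin n))

weight : ∀ {n} → F2 n → ℕ
weight [] = 0
weight (b ∷ v) = (if b then 1 else 0) + weight v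

flipMove : ∀ {n} → Adj n → Fin n → Mat n
flipMove adj s a b = ⌊ a ≟ b ⌋ ∨ (⌊ b ≟ s ⌋ ∧ adj a b)

-- u and v lie in the same W-orbit: v = g u for some g in
-- W = ⟨flipMove s⟩, i.e. g a finite product of generators
-- (the generators are involutions, so W is the monoid they generate).
data SameOrbit {n} (adj : Adj n) : F2 n → F2 n → Set where
  done : ∀ {u} → SameOrbit adj u u
  move : ∀ {u v} (s : Fin n) → SameOrbit adj (flipMove adj s · u) v → SameOrbit adj u v

IsOrbit : ∀ {n} → Adj n → (F2 n → Set) → Set
IsOrbit {n} adj P =
  (∃ λ u → P u) ×
  (∀ u v → P u → P v → SameOrbit adj u v) ×
  (∀ u v → P u → SameOrbit adj u v → P v)

NumOrbits : ∀ {n} → Adj n → ℕ → Set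
NumOrbits {n} adj c =
  Σ (Fin c → F2 n) λ r →
    (∀ i j → SameOrbit adj (r i) (r j) → i ≡ j) ×
    (∀ u → ∃ λ i → SameOrbit adj u (r i))

OrbitWeight : ∀ {n} → Adj n → F2 n → ℕ → Set
OrbitWeight {n} adj u k =
  (∃ λ v → SameOrbit adj u v × weight v ≡ k) ×
  (∀ v → SameOrbit adj u v → k ≤ weight v)

IsMaxWeight : ∀ {n} → Adj n → ℕ → Set
IsMaxWeight {n} adj k =
  (∃ λ u → OrbitWeight adj u k) ×
  (∀ u k' → OrbitWeight adj u k' → k' ≤ k)

-- The vectors \overline{1}, ..., \overline{n}  (n = suc m)
-- barN i p is \overline{i+1}:  \overline{1} = charV s_1,
-- \overline{i+2} = flipMove s_{i+1} · \overline{i+1}.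

barN : ∀ {m} → Adj (suc m) → (i : ℕ) → i < suc m → F2 (suc m)
barN adj zero p = charV zero
barN {m} adj (suc i) p =
  flipMove adj (fromℕ< (m<n⇒m<1+n (Data.Nat.s<s⁻¹ p))) · barN adj i (m<n⇒m<1+n (Data.Nat.s<s⁻¹ p))

-- bar adj k = \overline{toℕ k + 1}
bar : ∀ {m} → Adj (suc m) → Fin (suc m) → F2 (suc m)
bar adj k = barN adj (toℕ k) (toℕ<n k)

InΠ₁ : ∀ {m} → Adj (suc m) → Fin (suc m) → Bool
InΠ₁ {m} adj k = ⟨ bar adj k , charV (fromℕ m) ⟩

countΠ₁upTo : ∀ {m} → Adj (suc m) → ℕ → ℕ
countΠ₁upTo {m} adj i =
  length (filter (λ k → Data.Nat._<?_ (toℕ k) i)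
           (filter (λ k → Data.Bool._≟_ (InΠ₁ adj k) true) (allFin (suc m))))

sizeΠ₁ : ∀ {m} → Adj (suc m) → ℕ
sizeΠ₁ {m} adj = countΠ₁upTo adj (suc m)

InI : ∀ {m} → Adj (suc m) → ℕ → Set
InI {m} adj i =
  1 ≤ i × i ≤ suc m ×
  (Even (countΠ₁upTo adj i) ⊎ i ≡ suc m ⊎ Odd (countΠ₁upTo adj (suc m ∸ i)))

-- Subset-weight sets U_T with respect to the basis Δ = Π.
-- A subset D ⊆ Δ is an indicator vector over the indices of Π.

sumSubset : ∀ {m} → Adj (suc m) → Vec Bool (suc m) → F2 (suc m)
sumSubset {m} adj D =
  foldr _⊕_ zeroV (map (λ k → if lookup D k then bar adj k else zeroV) (allFin (suc m)))

InUT : ∀ {m} → Adj (suc m) → (ℕ → Set) → F2 (suc m) → Set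
InUT {m} adj T u = ∃ λ (D : Vec Bool (suc m)) → sumSubset adj D ≡ u × T (weight D)

-- Write a vector of F₂ⁿ as the set D ⊆ Δ = Π summing to it.  Flipping the path
-- vertex s_j exchanges membership of \overline{j} and \overline{j+1} in D, and
-- flipping s_n, when |D ∩ Π₁| is odd, complements D outside Π₁.  Transpositions
-- sort D, so an orbit is a union of the classes {|D| = w}, merged by the second
-- move: it sends |D| = a + b to a + |∁Π₁| - b, where a = |D ∩ Π₁| is odd and
-- b = |D ∖ Π₁|.  For |∁Π₁| = n - 1, 2, 1 this merges exactly the listed sizes.
-- In standard coordinates D = {\overline 1, …, \overline w} has at most one
-- change of value plus one parity bit, so every orbit has weight at most 2, and
-- a class reaches weight 1 exactly when it contains a size in I.

module Submission where

open import Defs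
open import Algebra.Bundles using (CommutativeRing)
open import Data.Bool using (T; Bool; true; false; _∧_; _xor_; not; if_then_else_)
open import Data.Bool.Properties
  using (xor-assoc; xor-same; xor-identityʳ; ∧-comm; ∧-zeroʳ; ∧-identityʳ; ∧-distribʳ-xor;
         xor-annihilates-not; not-distribˡ-xor; not-involutive; xor-∧-commutativeRing)
import Data.Bool.Properties as Boolₚ
open import Algebra.Properties.CommutativeSemigroup
  (CommutativeRing.+-commutativeSemigroup xor-∧-commutativeRing) using () renaming (interchange to xor-interchange)
open import Data.Empty using (⊥; ⊥-elim)
open import Data.Fin using (Fin; zero; suc; toℕ; fromℕ; fromℕ<; inject₁; _≟_)
open import Data.Fin.Properties using (toℕ-injective; toℕ-inject₁; toℕ-fromℕ<; toℕ<n; inject₁ℕ<)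
import Data.Fin.Properties as Finₚ
open import Data.List as List using (List)
open import Data.List.Properties using (map-tabulate; map-cong)
open import Data.Nat as ℕ using (ℕ; zero; suc; _+_; _*_; _∸_; _≤_; _<_; s≤s; z≤n; _≡ᵇ_; ⌊_/2⌋; ⌈_/2⌉)
import Data.Nat.Properties as ℕₚ
import Data.Nat.ListAction as ListAction
open import Algebra.Properties.CommutativeSemigroup ℕₚ.+-commutativeSemigroup using () renaming (x∙yz≈y∙xz to +-left-comm)
open import Data.Product using (∃; _×_; _,_; proj₁; proj₂)
open import Data.Sum using (_⊎_; inj₁; inj₂)
open import Data.Vec as Vec using (Vec; []; _∷_; lookup; tabulate; _∷ʳ_)
open import Data.Vec.Properties using (lookup∘tabulate; lookup-replicate; tabulate∘lookup; tabulate-cong; lookup-map; ∷ʳ-injective)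
open import Relation.Binary.PropositionalEquality
open import Relation.Nullary using (¬_; yes; no; Dec; does; _×-dec_; _⊎-dec_)
open import Relation.Nullary.Decidable using (⌊_⌋)

-- Linear algebra over F₂

xor-xor-cancelˡ : ∀ x y → (x xor (x xor y)) ≡ y
xor-xor-cancelˡ x y = trans (sym (xor-assoc x x y)) (cong (_xor y) (xor-same x))

xor-cancelʳ : ∀ x y → ((x xor y) xor y) ≡ x
xor-cancelʳ x y = trans (xor-assoc x y y) (trans (cong (x xor_) (xor-same y)) (xor-identityʳ x))

lookup-ext : ∀ {k} (u v : Vec Bool k) → (∀ a → lookup u a ≡ lookup v a) → u ≡ v
lookup-ext u v h = trans (sym (tabulate∘lookup u)) (trans (tabulate-cong h) (tabulate∘lookup v))

lookup-⊕ : ∀ {k} (u v : F2 k) a → lookup (u ⊕ v) a ≡ (lookup u a xor lookup v a)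
lookup-⊕ u v a = lookup∘tabulate _ a

lookup-zeroV : ∀ {k} (a : Fin k) → lookup (zeroV {k}) a ≡ false
lookup-zeroV a = lookup-replicate a false

⊕-identityʳ : ∀ {k} (u : F2 k) → u ⊕ zeroV ≡ u
⊕-identityʳ [] = refl
⊕-identityʳ (a ∷ u) = cong₂ _∷_ (xor-identityʳ a) (⊕-identityʳ u)

⊕-cancelˡ : ∀ {k} (u v : F2 k) → u ⊕ (u ⊕ v) ≡ v
⊕-cancelˡ [] [] = refl
⊕-cancelˡ (a ∷ u) (b ∷ v) =
  cong₂ _∷_ (xor-xor-cancelˡ a b) (⊕-cancelˡ u v)

⊕-cancelʳ : ∀ {k} (u v : F2 k) → (u ⊕ v) ⊕ v ≡ u
⊕-cancelʳ [] [] = refl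
⊕-cancelʳ (a ∷ u) (b ∷ v) =
  cong₂ _∷_ (xor-cancelʳ a b) (⊕-cancelʳ u v)

∷ʳ-⊕ : ∀ {k} (u v : F2 k) x y → (u ∷ʳ x) ⊕ (v ∷ʳ y) ≡ (u ⊕ v) ∷ʳ (x xor y)
∷ʳ-⊕ [] [] x y = refl
∷ʳ-⊕ (a ∷ u) (b ∷ v) x y = cong ((a xor b) ∷_) (∷ʳ-⊕ u v x y)

∷ʳ-zeroV : ∀ k → (zeroV {k}) ∷ʳ false ≡ zeroV
∷ʳ-zeroV zero = refl
∷ʳ-zeroV (suc k) = cong (false ∷_) (∷ʳ-zeroV k)

scale : ∀ {k} → Bool → F2 k → F2 k
scale true v = v
scale false v = zeroV

lookup-scale : ∀ {k} c (v : F2 k) a → lookup (scale c v) a ≡ (c ∧ lookup v a)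
lookup-scale true v a = refl
lookup-scale false v a = lookup-zeroV a

complement : ∀ {k} → F2 k → F2 k
complement = Vec.map not

sumOver : ∀ {k} → (Fin k → Bool) → Bool
sumOver f = sumF2 (List.tabulate f)

map-allFin : ∀ {k} (f : Fin k → Bool) → List.map f (List.allFin k) ≡ List.tabulate f
map-allFin f = map-tabulate (λ x → x) f

sumOver-cong : ∀ {k} (f g : Fin k → Bool) → (∀ b → f b ≡ g b) → sumOver f ≡ sumOver g
sumOver-cong {zero} f g h = refl
sumOver-cong {suc k} f g h = cong₂ _xor_ (h zero) (sumOver-cong _ _ (λ b → h (suc b)))

sumOver-zero : ∀ {k} (f : Fin k → Bool) → (∀ b → f b ≡ false) → sumOver f ≡ false
sumOver-zero {zero} f h = refl
sumOver-zero {suc k} f h rewrite h zero = sumOver-zero (λ b → f (suc b)) (λ b → h (suc b))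

sumOver-single : ∀ {k} (f : Fin k → Bool) a → (∀ b → b ≢ a → f b ≡ false) → sumOver f ≡ f a
sumOver-single {suc k} f zero h =
  trans (cong (f zero xor_) (sumOver-zero _ (λ b → h (suc b) (λ ())))) (xor-identityʳ _)
sumOver-single {suc k} f (suc a) h rewrite h zero (λ ()) =
  sumOver-single (λ b → f (suc b)) a (λ b b≢a → h (suc b) (λ e → b≢a (Finₚ.suc-injective e)))

sumOver-xor : ∀ {k} (f g : Fin k → Bool) → sumOver (λ b → f b xor g b) ≡ (sumOver f xor sumOver g)
sumOver-xor {zero} f g = refl
sumOver-xor {suc k} f g =
  trans (cong ((f zero xor g zero) xor_) (sumOver-xor (λ b → f (suc b)) (λ b → g (suc b))))
        (xor-interchange (f zero) (g zero) _ _)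

≟-refl : ∀ {k} (a : Fin k) → ⌊ a ≟ a ⌋ ≡ true
≟-refl a with a ≟ a
... | yes _ = refl
... | no a≢a = ⊥-elim (a≢a refl)

≟-≢ : ∀ {k} {a b : Fin k} → a ≢ b → ⌊ a ≟ b ⌋ ≡ false
≟-≢ {a = a} {b} a≢b with a ≟ b
... | yes a≡b = ⊥-elim (a≢b a≡b)
... | no _ = refl

≟-toℕ : ∀ {k} (a b : Fin k) → ⌊ a ≟ b ⌋ ≡ (toℕ a ≡ᵇ toℕ b)
≟-toℕ zero zero = refl
≟-toℕ zero (suc b) = refl
≟-toℕ (suc a) zero = refl
≟-toℕ (suc a) (suc b) with a ≟ b | ≟-toℕ a b
... | yes _ | e = e
... | no _ | e = e

lookup-charV : ∀ {k} (s a : Fin k) → lookup (charV s) a ≡ ⌊ a ≟ s ⌋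
lookup-charV s a = lookup∘tabulate _ a

sumOver-charV : ∀ {k} (f : Fin k → Bool) s → sumOver (λ a → lookup (charV s) a ∧ f a) ≡ f s
sumOver-charV f s =
  trans (sumOver-single _ s (λ b b≢s → cong (_∧ f b) (trans (lookup-charV s b) (≟-≢ b≢s))))
        (cong (_∧ f s) (trans (lookup-charV s s) (≟-refl s)))

charV-zero : ∀ {k} → charV {suc k} zero ≡ true ∷ zeroV
charV-zero {k} = cong (true ∷_) (all-false k)
  where
  all-false : ∀ k → tabulate {n = k} (λ _ → false) ≡ zeroV
  all-false zero = refl
  all-false (suc k) = cong (false ∷_) (all-false k)

charV-suc : ∀ {k} (s : Fin k) → charV {suc k} (suc s) ≡ false ∷ charV s
charV-suc s = cong (false ∷_) (tabulate-cong (λ a → trans (≟-toℕ (suc a) (suc s)) (sym (≟-toℕ a s))))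

⟨,charV⟩ : ∀ {k} (u : F2 k) s → ⟨ u , charV s ⟩ ≡ lookup u s
⟨,charV⟩ {k} u s = begin
  sumF2 (List.map (λ a → lookup u a ∧ lookup (charV s) a) (List.allFin k))
    ≡⟨ cong sumF2 (map-allFin (λ a → lookup u a ∧ lookup (charV s) a)) ⟩
  sumOver (λ a → lookup u a ∧ lookup (charV s) a)
    ≡⟨ sumOver-cong _ _ (λ a → ∧-comm (lookup u a) _) ⟩
  sumOver (λ a → lookup (charV s) a ∧ lookup u a)
    ≡⟨ sumOver-charV (lookup u) s ⟩
  lookup u s ∎
  where open ≡-Reasoning

lookup-foldr-⊕ : ∀ {k} {A : Set} (g : A → F2 k) (xs : List A) a →
  lookup (List.foldr _⊕_ zeroV (List.map g xs)) a ≡ sumF2 (List.map (λ x → lookup (g x) a) xs)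
lookup-foldr-⊕ g List.[] a = lookup-zeroV a
lookup-foldr-⊕ g (x List.∷ xs) a =
  trans (lookup-⊕ (g x) (List.foldr _⊕_ zeroV (List.map g xs)) a) (cong (lookup (g x) a xor_) (lookup-foldr-⊕ g xs a))

sum-charV : ∀ {k} (D : F2 k) →
  List.foldr _⊕_ zeroV (List.map (λ x → scale (lookup D x) (charV x)) (List.allFin k)) ≡ D
sum-charV {k} D = lookup-ext _ _ λ a → begin
  _ ≡⟨ lookup-foldr-⊕ (λ x → scale (lookup D x) (charV x)) (List.allFin k) a ⟩
  sumF2 (List.map (λ x → lookup (scale (lookup D x) (charV x)) a) (List.allFin k))
    ≡⟨ cong sumF2 (map-allFin (λ x → lookup (scale (lookup D x) (charV x)) a)) ⟩
  sumOver (λ x → lookup (scale (lookup D x) (charV x)) a)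
    ≡⟨ sumOver-cong _ _ (λ x → trans (lookup-scale (lookup D x) (charV x) a)
                                (trans (cong (lookup D x ∧_) (trans (lookup-charV x a) (trans (≟-sym a x) (sym (lookup-charV a x))))) (∧-comm (lookup D x) _))) ⟩
  sumOver (λ x → lookup (charV a) x ∧ lookup D x) ≡⟨ sumOver-charV (lookup D) a ⟩
  lookup D a ∎
  where
  open ≡-Reasoning
  ≟-sym : ∀ {k} (a x : Fin k) → ⌊ a ≟ x ⌋ ≡ ⌊ x ≟ a ⌋
  ≟-sym a x with a ≟ x | x ≟ a
  ... | yes _ | yes _ = refl
  ... | no _ | no _ = refl
  ... | yes a≡x | no x≢a = ⊥-elim (x≢a (sym a≡x))
  ... | no a≢x | yes x≡a = ⊥-elim (a≢x (sym x≡a))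

column : ∀ {k} → Adj k → Fin k → F2 k
column adj s = tabulate (λ a → adj a s)

lookup-· : ∀ {k} (M : Mat k) (x : F2 k) a → lookup (M · x) a ≡ sumOver (λ b → M a b ∧ lookup x b)
lookup-· {k} M x a = trans (lookup∘tabulate _ a) (cong sumF2 (map-allFin (λ b → M a b ∧ lookup x b)))

flipMove-entry : ∀ {k} (adj : Adj k) → (∀ a → adj a a ≡ false) → (s a b : Fin k) (x : Bool) →
  (flipMove adj s a b ∧ x) ≡ ((⌊ b ≟ a ⌋ ∧ x) xor (⌊ b ≟ s ⌋ ∧ (adj a s ∧ x)))
flipMove-entry adj irr s a b x with a ≟ b | b ≟ a | b ≟ s
... | yes refl | yes _ | yes refl rewrite irr a = sym (xor-identityʳ x)
... | yes refl | yes _ | no _ = sym (xor-identityʳ x)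
... | yes refl | no b≢b | _ = ⊥-elim (b≢b refl)
... | no a≢b | yes b≡a | _ = ⊥-elim (a≢b (sym b≡a))
... | no _ | no _ | yes refl = refl
... | no _ | no _ | no _ = refl

flipMove-· : ∀ {k} (adj : Adj k) → (∀ a → adj a a ≡ false) → (s : Fin k) (u : F2 k) →
  flipMove adj s · u ≡ u ⊕ scale (lookup u s) (column adj s)
flipMove-· adj irr s u = lookup-ext _ _ λ a → begin
  lookup (flipMove adj s · u) a
    ≡⟨ lookup-· _ u a ⟩
  sumOver (λ b → flipMove adj s a b ∧ lookup u b)
    ≡⟨ sumOver-cong _ _ (λ b → flipMove-entry adj irr s a b (lookup u b)) ⟩
  sumOver (λ b → (⌊ b ≟ a ⌋ ∧ lookup u b) xor (⌊ b ≟ s ⌋ ∧ (adj a s ∧ lookup u b)))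
    ≡⟨ sumOver-xor (λ b → ⌊ b ≟ a ⌋ ∧ lookup u b) (λ b → ⌊ b ≟ s ⌋ ∧ (adj a s ∧ lookup u b)) ⟩
  sumOver (λ b → ⌊ b ≟ a ⌋ ∧ lookup u b) xor sumOver (λ b → ⌊ b ≟ s ⌋ ∧ (adj a s ∧ lookup u b))
    ≡⟨ cong₂ _xor_ (sumOver-δ a (lookup u)) (sumOver-δ s (λ b → adj a s ∧ lookup u b)) ⟩
  lookup u a xor (adj a s ∧ lookup u s)
    ≡⟨ cong (lookup u a xor_) (trans (∧-comm (adj a s) (lookup u s))
                                     (sym (trans (lookup-scale (lookup u s) (column adj s) a)
                                                 (cong (lookup u s ∧_) (lookup∘tabulate (λ x → adj x s) a))))) ⟩
  lookup u a xor lookup (scale (lookup u s) (column adj s)) a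
    ≡⟨ sym (lookup-⊕ u (scale (lookup u s) (column adj s)) a) ⟩
  lookup (u ⊕ scale (lookup u s) (column adj s)) a ∎
  where
  open ≡-Reasoning
  sumOver-δ : ∀ {k} (c : Fin k) (f : Fin k → Bool) → sumOver (λ b → ⌊ b ≟ c ⌋ ∧ f b) ≡ f c
  sumOver-δ c f = trans (sumOver-cong _ _ (λ b → cong (_∧ f b) (sym (lookup-charV c b)))) (sumOver-charV f c)

-- Coordinates with respect to Δ

-- For P ∈ F₂ⁿ (later the indicator of Π₁), fromΔ P D lists the consecutive
-- differences of D followed by the parity of |D ∩ P|; for the graph S it is
-- D ↦ Σ_{k ∈ D} \overline{k} (sumSubset≡fromΔ below).

differences : ∀ {k} → Vec Bool (suc k) → Vec Bool k
differences (a ∷ []) = []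
differences (a ∷ b ∷ v) = (a xor b) ∷ differences (b ∷ v)

dot : ∀ {k} → Vec Bool k → Vec Bool k → Bool
dot [] [] = false
dot (d ∷ D) (p ∷ P) = (d ∧ p) xor dot D P

fromΔ : ∀ {m} → Vec Bool (suc m) → Vec Bool (suc m) → F2 (suc m)
fromΔ P D = differences D ∷ʳ dot D P

lookup-differences : ∀ {k} (v : Vec Bool (suc k)) (j : Fin k) →
  lookup (differences v) j ≡ (lookup v (inject₁ j) xor lookup v (suc j))
lookup-differences (a ∷ b ∷ v) zero = refl
lookup-differences (a ∷ b ∷ v) (suc j) = lookup-differences (b ∷ v) j

lookup-∷ʳ-inject₁ : ∀ {k} (v : Vec Bool k) x (j : Fin k) → lookup (v ∷ʳ x) (inject₁ j) ≡ lookup v j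
lookup-∷ʳ-inject₁ (y ∷ v) x zero = refl
lookup-∷ʳ-inject₁ (y ∷ v) x (suc j) = lookup-∷ʳ-inject₁ v x j

lookup-∷ʳ-last : ∀ {k} (v : Vec Bool k) x → lookup (v ∷ʳ x) (fromℕ k) ≡ x
lookup-∷ʳ-last [] x = refl
lookup-∷ʳ-last (y ∷ v) x = lookup-∷ʳ-last v x

lookup-fromΔ-inject₁ : ∀ {m} (P D : Vec Bool (suc m)) (j : Fin m) →
  lookup (fromΔ P D) (inject₁ j) ≡ (lookup D (inject₁ j) xor lookup D (suc j))
lookup-fromΔ-inject₁ P D j = trans (lookup-∷ʳ-inject₁ (differences D) _ j) (lookup-differences D j)

lookup-fromΔ-last : ∀ {m} (P D : Vec Bool (suc m)) → lookup (fromΔ P D) (fromℕ m) ≡ dot D P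
lookup-fromΔ-last P D = lookup-∷ʳ-last (differences D) _

data InjectOrLast {m} : Fin (suc m) → Set where
  inject : (j : Fin m) → InjectOrLast (inject₁ j)
  last : InjectOrLast (fromℕ m)

injectOrLast : ∀ {m} (a : Fin (suc m)) → InjectOrLast a
injectOrLast {zero} zero = last
injectOrLast {suc m} zero = inject zero
injectOrLast {suc m} (suc a) with injectOrLast a
... | inject j = inject (suc j)
... | last = last

lookup-ext-∷ʳ : ∀ {m} (u v : Vec Bool (suc m)) → (∀ j → lookup u (inject₁ j) ≡ lookup v (inject₁ j)) →
  lookup u (fromℕ m) ≡ lookup v (fromℕ m) → u ≡ v
lookup-ext-∷ʳ u v init≡ last≡ = lookup-ext u v λ a → go a (injectOrLast a)
  where
  go : ∀ a → InjectOrLast a → lookup u a ≡ lookup v a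
  go .(inject₁ j) (inject j) = init≡ j
  go .(fromℕ _) last = last≡

dot-sumOver : ∀ {k} (D P : Vec Bool k) → dot D P ≡ sumOver (λ a → lookup D a ∧ lookup P a)
dot-sumOver [] [] = refl
dot-sumOver (d ∷ D) (p ∷ P) = cong ((d ∧ p) xor_) (dot-sumOver D P)

dot-charVˡ : ∀ {k} (P : Vec Bool k) s → dot (charV s) P ≡ lookup P s
dot-charVˡ P s = trans (dot-sumOver (charV s) P) (sumOver-charV (lookup P) s)

dot-zeroVˡ : ∀ {k} (P : Vec Bool k) → dot zeroV P ≡ false
dot-zeroVˡ [] = refl
dot-zeroVˡ (p ∷ P) = dot-zeroVˡ P

dot-⊕ˡ : ∀ {k} (D E P : Vec Bool k) → dot (D ⊕ E) P ≡ (dot D P xor dot E P)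
dot-⊕ˡ [] [] [] = refl
dot-⊕ˡ (d ∷ D) (e ∷ E) (p ∷ P) =
  trans (cong₂ _xor_ (∧-distribʳ-xor p d e) (dot-⊕ˡ D E P)) (xor-interchange (d ∧ p) (e ∧ p) _ _)

dot-scaleˡ : ∀ {k} c (D P : Vec Bool k) → dot (scale c D) P ≡ (c ∧ dot D P)
dot-scaleˡ true D P = refl
dot-scaleˡ false D P = dot-zeroVˡ P

dot-complementˡ : ∀ {k} (D P : Vec Bool k) → dot (complement D) P ≡ (dot P P xor dot D P)
dot-complementˡ [] [] = refl
dot-complementˡ (d ∷ D) (true ∷ P) = begin
  (not d ∧ true) xor dot (complement D) P ≡⟨ cong₂ _xor_ (∧-identityʳ (not d)) (dot-complementˡ D P) ⟩
  not d xor (dot P P xor dot D P)         ≡⟨ not-xor-exchange d (dot P P) (dot D P) ⟩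
  not (dot P P) xor ((d ∧ true) xor dot D P) ∎
  where
  open ≡-Reasoning
  not-xor-exchange : ∀ x y z → (not x xor (y xor z)) ≡ (not y xor ((x ∧ true) xor z))
  not-xor-exchange true true z = refl
  not-xor-exchange true false z = sym (not-involutive z)
  not-xor-exchange false true z = not-involutive z
  not-xor-exchange false false z = refl
dot-complementˡ (true ∷ D) (false ∷ P) = dot-complementˡ D P
dot-complementˡ (false ∷ D) (false ∷ P) = dot-complementˡ D P

dot-complement-self : ∀ {k} (P : Vec Bool k) → dot (complement P) P ≡ false
dot-complement-self [] = refl
dot-complement-self (true ∷ P) = dot-complement-self P
dot-complement-self (false ∷ P) = dot-complement-self P

differences-⊕ : ∀ {k} (D E : Vec Bool (suc k)) → differences (D ⊕ E) ≡ differences D ⊕ differences E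
differences-⊕ (a ∷ []) (c ∷ []) = refl
differences-⊕ (a ∷ b ∷ v) (c ∷ d ∷ w) = cong₂ _∷_ (xor-interchange a c b d) (differences-⊕ (b ∷ v) (d ∷ w))

differences-zeroV : ∀ k → differences (zeroV {suc k}) ≡ zeroV
differences-zeroV zero = refl
differences-zeroV (suc k) = cong (false ∷_) (differences-zeroV k)

differences-complement : ∀ {k} (D : Vec Bool (suc k)) → differences (complement D) ≡ differences D
differences-complement (a ∷ []) = refl
differences-complement (a ∷ b ∷ v) = cong₂ _∷_ (xor-annihilates-not a b) (differences-complement (b ∷ v))

fromΔ-⊕ : ∀ {m} (P D E : Vec Bool (suc m)) → fromΔ P (D ⊕ E) ≡ fromΔ P D ⊕ fromΔ P E
fromΔ-⊕ P D E = trans (cong₂ _∷ʳ_ (differences-⊕ D E) (dot-⊕ˡ D E P)) (sym (∷ʳ-⊕ (differences D) (differences E) _ _))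

fromΔ-zeroV : ∀ {m} (P : Vec Bool (suc m)) → fromΔ P zeroV ≡ zeroV
fromΔ-zeroV {m} P = trans (cong₂ _∷ʳ_ (differences-zeroV m) (dot-zeroVˡ P)) (∷ʳ-zeroV m)

fromΔ-scale : ∀ {m} (P : Vec Bool (suc m)) c D → fromΔ P (scale c D) ≡ scale c (fromΔ P D)
fromΔ-scale P true D = refl
fromΔ-scale P false D = fromΔ-zeroV P

fromΔ-foldr-⊕ : ∀ {m} {A : Set} (P : Vec Bool (suc m)) (g : A → Vec Bool (suc m)) xs →
  List.foldr _⊕_ zeroV (List.map (λ x → fromΔ P (g x)) xs) ≡ fromΔ P (List.foldr _⊕_ zeroV (List.map g xs))
fromΔ-foldr-⊕ P g List.[] = sym (fromΔ-zeroV P)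
fromΔ-foldr-⊕ P g (x List.∷ xs) =
  trans (cong (fromΔ P (g x) ⊕_) (fromΔ-foldr-⊕ P g xs)) (sym (fromΔ-⊕ P (g x) (List.foldr _⊕_ zeroV (List.map g xs))))

-- Parity and weight

bit : Bool → ℕ
bit b = if b then 1 else 0

isOdd : ℕ → Bool
isOdd zero = false
isOdd (suc n) = not (isOdd n)

isOdd-+ : ∀ a b → isOdd (a + b) ≡ (isOdd a xor isOdd b)
isOdd-+ zero b = refl
isOdd-+ (suc a) b = trans (cong not (isOdd-+ a b)) (not-distribˡ-xor (isOdd a) (isOdd b))

isOdd-double : ∀ t → isOdd (t + t) ≡ false
isOdd-double t = trans (isOdd-+ t t) (xor-same (isOdd t))

isOdd-bit+ : ∀ p c → isOdd (bit p + c) ≡ (p xor isOdd c)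
isOdd-bit+ true c = refl
isOdd-bit+ false c = refl

%2≡bit∘isOdd : ∀ k → k ℕ.% 2 ≡ bit (isOdd k)
%2≡bit∘isOdd zero = refl
%2≡bit∘isOdd (suc zero) = refl
%2≡bit∘isOdd (suc (suc k)) =
  trans (trans (cong (ℕ._% 2) (ℕₚ.+-comm 2 k)) (DivMod.[m+n]%n≡m%n k 2))
        (trans (%2≡bit∘isOdd k) (cong bit (sym (not-involutive (isOdd k)))))
  where import Data.Nat.DivMod as DivMod

Odd⇒isOdd : ∀ k → Odd k → isOdd k ≡ true
Odd⇒isOdd k o with isOdd k | %2≡bit∘isOdd k
... | true | _ = refl
... | false | e with () ← trans (sym e) o

isOdd⇒Odd : ∀ k → isOdd k ≡ true → Odd k
isOdd⇒Odd k e = trans (%2≡bit∘isOdd k) (cong bit e)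

Even⇒¬isOdd : ∀ k → Even k → isOdd k ≡ false
Even⇒¬isOdd k o with isOdd k | %2≡bit∘isOdd k
... | false | _ = refl
... | true | e with () ← trans (sym e) o

¬isOdd⇒Even : ∀ k → isOdd k ≡ false → Even k
¬isOdd⇒Even k e = trans (%2≡bit∘isOdd k) (cong bit e)

isOdd⇒odd-form : ∀ k → isOdd k ≡ true → ∃ λ t → k ≡ suc (t + t)
¬isOdd⇒even-form : ∀ k → isOdd k ≡ false → ∃ λ t → k ≡ t + t
isOdd⇒odd-form zero ()
isOdd⇒odd-form (suc k) e with ¬isOdd⇒even-form k (trans (sym (not-involutive (isOdd k))) (cong not e))
... | t , refl = t , refl
¬isOdd⇒even-form zero e = 0 , refl
¬isOdd⇒even-form (suc k) e with isOdd⇒odd-form k (trans (sym (not-involutive (isOdd k))) (cong not e))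
... | t , refl = suc t , cong suc (sym (ℕₚ.+-suc t t))

odd≢double : ∀ t w → isOdd w ≡ true → w ≢ t + t
odd≢double t w o refl with () ← trans (sym o) (isOdd-double t)

isOdd-2* : ∀ k → isOdd (2 * k) ≡ false
isOdd-2* k = trans (cong (λ x → isOdd (k + x)) (ℕₚ.+-identityʳ k)) (isOdd-double k)

weight-zeroV : ∀ k → weight (zeroV {k}) ≡ 0
weight-zeroV zero = refl
weight-zeroV (suc k) = weight-zeroV k

weight≡0⇒zeroV : ∀ {k} (v : Vec Bool k) → weight v ≡ 0 → v ≡ zeroV
weight≡0⇒zeroV [] e = refl
weight≡0⇒zeroV (false ∷ v) e = cong (false ∷_) (weight≡0⇒zeroV v e)

weight≤length : ∀ {k} (D : Vec Bool k) → weight D ≤ k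
weight≤length [] = z≤n
weight≤length (true ∷ D) = s≤s (weight≤length D)
weight≤length (false ∷ D) = ℕₚ.m≤n⇒m≤1+n (weight≤length D)

weight-∷ʳ : ∀ {k} (v : Vec Bool k) x → weight (v ∷ʳ x) ≡ weight v + bit x
weight-∷ʳ [] x = ℕₚ.+-comm (bit x) 0
weight-∷ʳ (y ∷ v) x = trans (cong (bit y +_) (weight-∷ʳ v x)) (sym (ℕₚ.+-assoc (bit y) _ _))

weight+weight-complement : ∀ {k} (X : Vec Bool k) → weight X + weight (complement X) ≡ k
weight+weight-complement [] = refl
weight+weight-complement (true ∷ X) = cong suc (weight+weight-complement X)
weight+weight-complement (false ∷ X) = trans (ℕₚ.+-suc (weight X) _) (cong suc (weight+weight-complement X))

weight-complement : ∀ {k} (X : Vec Bool k) → weight (complement X) ≡ k ∸ weight X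
weight-complement {k} X = trans (sym (ℕₚ.m+n∸m≡n (weight X) _)) (cong (_∸ weight X) (weight+weight-complement X))

dot-self : ∀ {k} (P : Vec Bool k) → dot P P ≡ isOdd (weight P)
dot-self [] = refl
dot-self (p ∷ P) = trans (cong₂ _xor_ (∧-idem p) (dot-self P)) (sym (isOdd-bit+ p (weight P)))
  where
  ∧-idem : ∀ p → (p ∧ p) ≡ p
  ∧-idem true = refl
  ∧-idem false = refl

weight-fromΔ : ∀ {m} (P D : Vec Bool (suc m)) → weight (fromΔ P D) ≡ weight (differences D) + bit (dot D P)
weight-fromΔ P D = weight-∷ʳ (differences D) (dot D P)

ones : (k w : ℕ) → Vec Bool k
ones zero w = []
ones (suc k) zero = false ∷ ones k zero
ones (suc k) (suc w) = true ∷ ones k w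

ones-zero : ∀ k → ones k 0 ≡ zeroV
ones-zero zero = refl
ones-zero (suc k) = cong (false ∷_) (ones-zero k)

weight-ones : ∀ k w → w ≤ k → weight (ones k w) ≡ w
weight-ones zero zero _ = refl
weight-ones (suc k) zero _ = weight-ones k zero z≤n
weight-ones (suc k) (suc w) (s≤s w≤k) = cong suc (weight-ones k w w≤k)

weight-differences-ones₀ : ∀ k → weight (differences (ones (suc k) 0)) ≡ 0
weight-differences-ones₀ k = trans (cong (λ v → weight (differences v)) (ones-zero (suc k)))
                                   (trans (cong weight (differences-zeroV k)) (weight-zeroV k))

weight-differences-ones≤1 : ∀ k w → weight (differences (ones (suc k) w)) ≤ 1
weight-differences-ones≤1 zero zero = z≤n
weight-differences-ones≤1 zero (suc w) = z≤n
weight-differences-ones≤1 (suc k) zero = ℕₚ.≤-trans (ℕₚ.≤-reflexive (weight-differences-ones₀ (suc k))) z≤n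
weight-differences-ones≤1 (suc k) (suc zero) = ℕₚ.≤-reflexive (cong suc (weight-differences-ones₀ k))
weight-differences-ones≤1 (suc k) (suc (suc w)) = weight-differences-ones≤1 k (suc w)

weight-differences-ones≡1 : ∀ k j → 1 ≤ j → j ≤ k → weight (differences (ones (suc k) j)) ≡ 1
weight-differences-ones≡1 (suc k) (suc zero) _ _ = cong suc (weight-differences-ones₀ k)
weight-differences-ones≡1 (suc k) (suc (suc j)) _ (s≤s j≤k) = weight-differences-ones≡1 k (suc j) (s≤s z≤n) j≤k

countPrefix : ∀ {k} → ℕ → Vec Bool k → ℕ
countPrefix zero P = 0
countPrefix (suc j) [] = 0
countPrefix (suc j) (p ∷ P) = bit p + countPrefix j P

countPrefix-all : ∀ {k} (P : Vec Bool k) → countPrefix k P ≡ weight P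
countPrefix-all [] = refl
countPrefix-all (p ∷ P) = cong (bit p +_) (countPrefix-all P)

dot-ones : ∀ {k} j (P : Vec Bool k) → dot (ones k j) P ≡ isOdd (countPrefix j P)
dot-ones zero [] = refl
dot-ones (suc j) [] = refl
dot-ones zero (p ∷ P) = dot-ones zero P
dot-ones (suc j) (p ∷ P) = trans (cong (p xor_) (dot-ones j P)) (sym (isOdd-bit+ p (countPrefix j P)))

+≡⇒≡∸ : ∀ {a b N} → a + b ≡ N → a ≡ N ∸ b
+≡⇒≡∸ {a} {b} refl = sym (ℕₚ.m+n∸n≡m a b)

∃-≡⊎≡⇒⊎ : ∀ {R : ℕ → Set} {a b} → (∃ λ k → (k ≡ a ⊎ k ≡ b) × R k) → R a ⊎ R b
∃-≡⊎≡⇒⊎ (k , inj₁ refl , r) = inj₁ r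
∃-≡⊎≡⇒⊎ (k , inj₂ refl , r) = inj₂ r

⊎⇒∃-≡⊎≡ : ∀ {R : ℕ → Set} {a b} → R a ⊎ R b → ∃ λ k → (k ≡ a ⊎ k ≡ b) × R k
⊎⇒∃-≡⊎≡ {a = a} (inj₁ r) = a , inj₁ refl , r
⊎⇒∃-≡⊎≡ {b = b} (inj₂ r) = b , inj₂ refl , r

∀-between? : (R : ℕ → Set) → (∀ i → Dec (R i)) → ∀ N →
  (∀ i → 1 ≤ i → i ≤ N → R i) ⊎ (∃ λ i → 1 ≤ i × i ≤ N × ¬ R i)
∀-between? R R? zero = inj₁ (λ i 1≤i i≤0 → ⊥-elim (ℕₚ.<-irrefl refl (ℕₚ.≤-trans 1≤i i≤0)))
∀-between? R R? (suc N) with ∀-between? R R? N | R? (suc N)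
... | inj₂ (i , 1≤i , i≤N , ¬r) | _ = inj₂ (i , 1≤i , ℕₚ.m≤n⇒m≤1+n i≤N , ¬r)
... | inj₁ _ | no ¬r = inj₂ (suc N , s≤s z≤n , ℕₚ.≤-refl , ¬r)
... | inj₁ below | yes r = inj₁ λ i 1≤i i≤N+1 → case (ℕₚ.m≤n⇒m<n∨m≡n i≤N+1) 1≤i
  where
  case : ∀ {i} → i < suc N ⊎ i ≡ suc N → 1 ≤ i → R i
  case (inj₁ (s≤s i≤N)) 1≤i = below _ 1≤i i≤N
  case (inj₂ refl) _ = r

∃-below? : (R : ℕ → Set) → (∀ i → Dec (R i)) → ∀ N → (∀ i → R i → i < N) → Dec (∃ R)
∃-below? R R? N bounded with Finₚ.any? {n = N} (λ k → R? (toℕ k))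
... | yes (k , r) = yes (toℕ k , r)
... | no none = no λ (i , r) → none (fromℕ< (bounded i r) , subst R (sym (toℕ-fromℕ< (bounded i r))) r)

-- Inverting fromΔ when |P| is odd

integrate : ∀ {k} → Bool → Vec Bool k → Vec Bool (suc k)
integrate c [] = c ∷ []
integrate c (y ∷ v) = c ∷ integrate (c xor y) v

differences-integrate : ∀ {k} c (v : Vec Bool k) → differences (integrate c v) ≡ v
differences-integrate c [] = refl
differences-integrate c (y ∷ []) = cong (_∷ []) (xor-xor-cancelˡ c y)
differences-integrate c (y ∷ z ∷ v) = cong₂ _∷_ (xor-xor-cancelˡ c y) (differences-integrate (c xor y) (z ∷ v))

integrate-not : ∀ {k} c (v : Vec Bool k) → integrate (not c) v ≡ complement (integrate c v)
integrate-not c [] = refl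
integrate-not c (y ∷ v) =
  cong (not c ∷_) (trans (cong (λ t → integrate t v) (sym (not-distribˡ-xor c y))) (integrate-not (c xor y) v))

integrate-differences : ∀ {k} (D : Vec Bool (suc k)) → integrate (Vec.head D) (differences D) ≡ D
integrate-differences (a ∷ []) = refl
integrate-differences (a ∷ b ∷ v) =
  cong (a ∷_) (trans (cong (λ t → integrate t (differences (b ∷ v))) (xor-xor-cancelˡ a b)) (integrate-differences (b ∷ v)))

integrate-zeroV : ∀ k → integrate false (zeroV {k}) ≡ zeroV
integrate-zeroV zero = refl
integrate-zeroV (suc k) = cong (false ∷_) (integrate-zeroV k)

integrate-weight≡1 : ∀ {k} (v : Vec Bool k) → weight v ≡ 1 →
  ∃ λ j → 1 ≤ j × j ≤ k × integrate true v ≡ ones (suc k) j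
integrate-weight≡1 (true ∷ v) e with weight≡0⇒zeroV v (ℕₚ.suc-injective e)
... | refl = 1 , s≤s z≤n , s≤s z≤n , cong (true ∷_) (trans (integrate-zeroV _) (sym (ones-zero _)))
integrate-weight≡1 (false ∷ v) e with integrate-weight≡1 v e
... | j , 1≤j , j≤k , eq = suc j , s≤s z≤n , s≤s j≤k , cong (true ∷_) eq

allOnes : ∀ {k} → F2 k
allOnes = complement zeroV

weight-allOnes : ∀ k → weight (allOnes {k}) ≡ k
weight-allOnes k = trans (cong (_+ weight (allOnes {k})) (sym (weight-zeroV k))) (weight+weight-complement (zeroV {k}))

-- i ∈ I, reading |[\overline j] ∩ Π₁| as the number of ones among the first j entries of P
InIᴾ : ∀ {m} → Vec Bool (suc m) → ℕ → Set
InIᴾ {m} P i = 1 ≤ i × i ≤ suc m × (Even (countPrefix i P) ⊎ i ≡ suc m ⊎ Odd (countPrefix (suc m ∸ i) P))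

weight-fromΔ-ones≤2 : ∀ {m} (P : Vec Bool (suc m)) w → weight (fromΔ P (ones (suc m) w)) ≤ 2
weight-fromΔ-ones≤2 {m} P w =
  subst (_≤ 2) (sym (weight-fromΔ P (ones (suc m) w))) (ℕₚ.+-mono-≤ (weight-differences-ones≤1 m w) (bit≤1 _))
  where
  bit≤1 : ∀ b → bit b ≤ 1
  bit≤1 true = s≤s z≤n
  bit≤1 false = z≤n

module OddWeight {m} (P : Vec Bool (suc m)) (P-odd : isOdd (weight P) ≡ true) where

  n : ℕ
  n = suc m

  dot-complement : ∀ X → dot (complement X) P ≡ not (dot X P)
  dot-complement X = trans (dot-complementˡ X P) (cong (_xor dot X P) (trans (dot-self P) P-odd))

  dot-integrate : ∀ c (v : Vec Bool m) → dot (integrate c v) P ≡ (c xor dot (integrate false v) P)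
  dot-integrate false v = refl
  dot-integrate true v = trans (cong (λ X → dot X P) (integrate-not false v)) (dot-complement (integrate false v))

  head-determined : ∀ (D : Vec Bool n) → Vec.head D ≡ (dot D P xor dot (integrate false (differences D)) P)
  head-determined D = begin
    Vec.head D ≡⟨ sym (xor-cancelʳ (Vec.head D) b) ⟩
    (Vec.head D xor b) xor b ≡⟨ cong (_xor b) (sym (dot-integrate (Vec.head D) (differences D))) ⟩
    dot (integrate (Vec.head D) (differences D)) P xor b ≡⟨ cong (λ X → dot X P xor b) (integrate-differences D) ⟩
    dot D P xor b ∎
    where
    open ≡-Reasoning
    b = dot (integrate false (differences D)) P

  fromΔ-surjective : ∀ (u : F2 n) → ∃ λ D → fromΔ P D ≡ u
  fromΔ-surjective u with Vec.initLast u
  ... | v , x , refl = integrate c v , cong₂ _∷ʳ_ (differences-integrate c v) dot≡x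
    where
    b = dot (integrate false v) P
    c = x xor b
    dot≡x : dot (integrate c v) P ≡ x
    dot≡x = trans (dot-integrate c v) (xor-cancelʳ x b)

  fromΔ-injective : ∀ D E → fromΔ P D ≡ fromΔ P E → D ≡ E
  fromΔ-injective D E eq with ∷ʳ-injective (differences D) (differences E) eq
  ... | diff≡ , dot≡ = begin
    D                                          ≡⟨ sym (integrate-differences D) ⟩
    integrate (Vec.head D) (differences D)     ≡⟨ cong₂ integrate head≡ diff≡ ⟩
    integrate (Vec.head E) (differences E)     ≡⟨ integrate-differences E ⟩
    E ∎
    where
    open ≡-Reasoning
    head≡ : Vec.head D ≡ Vec.head E
    head≡ = trans (head-determined D)
              (trans (cong₂ (λ x v → x xor dot (integrate false v) P) dot≡ diff≡) (sym (head-determined E)))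

  differences≡0⇒constant : ∀ (D : Vec Bool n) → differences D ≡ zeroV → D ≡ zeroV ⊎ D ≡ allOnes
  differences≡0⇒constant D diff≡0 with Vec.head D in h
  ... | false = inj₁ (trans (sym (integrate-differences D)) (trans (cong₂ integrate h diff≡0) (integrate-zeroV m)))
  ... | true = inj₂ (trans (sym (integrate-differences D))
                      (trans (cong₂ integrate h diff≡0) (trans (integrate-not false zeroV) (cong complement (integrate-zeroV m)))))

  dot-allOnes : dot allOnes P ≡ true
  dot-allOnes = trans (dot-complement zeroV) (cong not (dot-zeroVˡ P))

  weight-fromΔ≡0 : ∀ D → weight (fromΔ P D) ≡ 0 → D ≡ zeroV
  weight-fromΔ≡0 D e = go (differences≡0⇒constant D (weight≡0⇒zeroV _ (ℕₚ.m+n≡0⇒m≡0 _ e′)))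
    where
    e′ : weight (differences D) + bit (dot D P) ≡ 0
    e′ = trans (sym (weight-fromΔ P D)) e
    bit≡0 : ∀ b → bit b ≡ 0 → b ≡ false
    bit≡0 false _ = refl
    go : D ≡ zeroV ⊎ D ≡ allOnes → D ≡ zeroV
    go (inj₁ D≡0) = D≡0
    go (inj₂ refl) with () ← trans (sym dot-allOnes) (bit≡0 _ (ℕₚ.m+n≡0⇒n≡0 _ e′))

  data WeightOneShape (D : Vec Bool n) : Set where
    all-ones : D ≡ allOnes → WeightOneShape D
    ones-prefix : ∀ j → 1 ≤ j → j ≤ m → D ≡ ones n j → Even (countPrefix j P) → WeightOneShape D
    zeros-prefix : ∀ j → 1 ≤ j → j ≤ m → D ≡ complement (ones n j) → Odd (countPrefix j P) → WeightOneShape D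

  weight-fromΔ≡1-shape : ∀ D → weight (fromΔ P D) ≡ 1 → WeightOneShape D
  weight-fromΔ≡1-shape D e = split (weight (differences D)) (dot D P) refl refl (trans (sym (weight-fromΔ P D)) e)
    where
    split : ∀ a d → weight (differences D) ≡ a → dot D P ≡ d → a + bit d ≡ 1 → WeightOneShape D
    split zero true wd≡0 dot≡1 _ with differences≡0⇒constant D (weight≡0⇒zeroV _ wd≡0)
    ... | inj₂ D≡1 = all-ones D≡1
    ... | inj₁ refl with () ← trans (sym dot≡1) (dot-zeroVˡ P)
    split (suc zero) false wd≡1 dot≡0 _ with integrate-weight≡1 (differences D) wd≡1 | Vec.head D in h
    ... | j , 1≤j , j≤m , int≡ | true =
      ones-prefix j 1≤j j≤m D≡ (¬isOdd⇒Even (countPrefix j P) (trans (sym (dot-ones j P)) (trans (cong (λ X → dot X P) (sym D≡)) dot≡0)))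
      where
      D≡ : D ≡ ones n j
      D≡ = trans (sym (integrate-differences D)) (trans (cong (λ c → integrate c (differences D)) h) int≡)
    ... | j , 1≤j , j≤m , int≡ | false =
      zeros-prefix j 1≤j j≤m D≡ (isOdd⇒Odd (countPrefix j P) (trans (sym (dot-ones j P)) (not-false (trans (sym (dot-complement (ones n j)))
                                                                   (trans (cong (λ X → dot X P) (sym D≡)) dot≡0)))))
      where
      D≡ : D ≡ complement (ones n j)
      D≡ = trans (sym (integrate-differences D))
             (trans (cong (λ c → integrate c (differences D)) h) (trans (integrate-not true (differences D)) (cong complement int≡)))
      not-false : ∀ {b} → not b ≡ false → b ≡ true
      not-false {true} _ = refl
    split zero false _ _ ()
    split (suc zero) true _ _ ()
    split (suc (suc _)) _ _ _ ()

  weight-fromΔ≡1⇒InIᴾ : ∀ D → weight (fromΔ P D) ≡ 1 → InIᴾ P (weight D)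
  weight-fromΔ≡1⇒InIᴾ D e with weight-fromΔ≡1-shape D e
  ... | all-ones refl = subst (InIᴾ P) (sym (weight-allOnes n)) (s≤s z≤n , ℕₚ.≤-refl , inj₂ (inj₁ refl))
  ... | ones-prefix j 1≤j j≤m refl even =
    subst (InIᴾ P) (sym (weight-ones n j j≤n)) (1≤j , j≤n , inj₁ even)
    where j≤n = ℕₚ.m≤n⇒m≤1+n j≤m
  ... | zeros-prefix j 1≤j j≤m refl odd =
    subst (InIᴾ P) (sym weight≡) (ℕₚ.m<n⇒0<n∸m (s≤s j≤m) , ℕₚ.m∸n≤m n j , inj₂ (inj₂ (subst (λ t → Odd (countPrefix t P)) (sym (ℕₚ.m∸[m∸n]≡n j≤n)) odd)))
    where
    j≤n = ℕₚ.m≤n⇒m≤1+n j≤m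
    weight≡ : weight (complement (ones n j)) ≡ n ∸ j
    weight≡ = trans (weight-complement (ones n j)) (cong (n ∸_) (weight-ones n j j≤n))

  InIᴾ⇒weight-fromΔ≡1 : ∀ i → InIᴾ P i → ∃ λ D → weight D ≡ i × weight (fromΔ P D) ≡ 1
  InIᴾ⇒weight-fromΔ≡1 i (_ , _ , inj₂ (inj₁ refl)) = allOnes , weight-allOnes n , weight-fromΔ-allOnes
    where
    weight-fromΔ-allOnes : weight (fromΔ P allOnes) ≡ 1
    weight-fromΔ-allOnes = trans (weight-fromΔ P allOnes)
      (cong₂ _+_ (trans (cong weight (trans (differences-complement (zeroV {n})) (differences-zeroV m))) (weight-zeroV m))
                 (cong bit dot-allOnes))
  InIᴾ⇒weight-fromΔ≡1 i (1≤i , i≤n , inj₁ even) with ℕₚ.m≤n⇒m<n∨m≡n i≤n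
  ... | inj₂ refl = InIᴾ⇒weight-fromΔ≡1 i (1≤i , i≤n , inj₂ (inj₁ refl))
  ... | inj₁ (s≤s i≤m) = ones n i , weight-ones n i i≤n ,
    trans (weight-fromΔ P (ones n i))
          (cong₂ _+_ (weight-differences-ones≡1 m i 1≤i i≤m) (cong bit (trans (dot-ones i P) (Even⇒¬isOdd (countPrefix i P) even))))
  InIᴾ⇒weight-fromΔ≡1 i (1≤i , i≤n , inj₂ (inj₂ odd)) = complement (ones n j) , weight≡ ,
    trans (weight-fromΔ P (complement (ones n j)))
          (cong₂ _+_ (trans (cong weight (differences-complement (ones n j))) (weight-differences-ones≡1 m j 1≤j j≤m))
                     (cong bit (trans (dot-complement (ones n j)) (cong not (trans (dot-ones j P) (Odd⇒isOdd (countPrefix j P) odd))))))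
    where
    j = n ∸ i
    j≤m : j ≤ m
    j≤m = ℕₚ.∸-monoʳ-≤ n 1≤i
    1≤j : 1 ≤ j
    1≤j = positive j odd
      where
      positive : ∀ t → Odd (countPrefix t P) → 1 ≤ t
      positive (suc t) _ = s≤s z≤n
    weight≡ : weight (complement (ones n j)) ≡ i
    weight≡ = trans (weight-complement (ones n j)) (trans (cong (n ∸_) (weight-ones n j (ℕₚ.m∸n≤m n i))) (ℕₚ.m∸[m∸n]≡n i≤n))

-- Adjacent transpositions and τ

swapAt : ∀ {k} → ℕ → Vec Bool k → Vec Bool k
swapAt zero (a ∷ b ∷ v) = b ∷ a ∷ v
swapAt (suc j) (a ∷ v) = a ∷ swapAt j v
swapAt _ v = v

swapAt-involutive : ∀ {k} j (D : Vec Bool k) → swapAt j (swapAt j D) ≡ D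
swapAt-involutive zero [] = refl
swapAt-involutive zero (a ∷ []) = refl
swapAt-involutive zero (a ∷ b ∷ v) = refl
swapAt-involutive (suc j) [] = refl
swapAt-involutive (suc j) (a ∷ v) = cong (a ∷_) (swapAt-involutive j v)

weight-swapAt : ∀ {k} j (D : Vec Bool k) → weight (swapAt j D) ≡ weight D
weight-swapAt zero [] = refl
weight-swapAt zero (a ∷ []) = refl
weight-swapAt zero (a ∷ b ∷ v) = +-left-comm (bit b) (bit a) (weight v)
weight-swapAt (suc j) [] = refl
weight-swapAt (suc j) (a ∷ v) = cong (bit a +_) (weight-swapAt j v)

swapAt-as-⊕ : ∀ {m} (D : Vec Bool (suc m)) (j : Fin m) →
  D ⊕ scale (lookup D (inject₁ j) xor lookup D (suc j)) (charV (inject₁ j) ⊕ charV (suc j)) ≡ swapAt (toℕ j) D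
swapAt-as-⊕ (a ∷ b ∷ v) zero = begin
  (a ∷ b ∷ v) ⊕ scale (a xor b) (charV zero ⊕ charV (suc zero))
    ≡⟨ cong (λ t → (a ∷ b ∷ v) ⊕ scale (a xor b) t) e₀+e₁ ⟩
  (a ∷ b ∷ v) ⊕ scale (a xor b) (true ∷ true ∷ zeroV)
    ≡⟨ swap-two a b v ⟩
  b ∷ a ∷ v ∎
  where
  open ≡-Reasoning
  e₀+e₁ : charV zero ⊕ charV (suc zero) ≡ true ∷ true ∷ zeroV
  e₀+e₁ = trans (cong₂ _⊕_ charV-zero (trans (charV-suc zero) (cong (false ∷_) charV-zero)))
                (cong (λ t → true ∷ true ∷ t) (⊕-identityʳ zeroV))
  swap-two : ∀ {k} a b (v : Vec Bool k) → (a ∷ b ∷ v) ⊕ scale (a xor b) (true ∷ true ∷ zeroV) ≡ b ∷ a ∷ v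
  swap-two true true v = cong (λ t → true ∷ true ∷ t) (⊕-identityʳ v)
  swap-two false false v = cong (λ t → false ∷ false ∷ t) (⊕-identityʳ v)
  swap-two true false v = cong (λ t → false ∷ true ∷ t) (⊕-identityʳ v)
  swap-two false true v = cong (λ t → true ∷ false ∷ t) (⊕-identityʳ v)
swapAt-as-⊕ {suc m} (a ∷ D) (suc j) = begin
  (a ∷ D) ⊕ scale c (charV (suc (inject₁ j)) ⊕ charV (suc (suc j)))
    ≡⟨ cong (λ t → (a ∷ D) ⊕ scale c t) (cong₂ _⊕_ (charV-suc (inject₁ j)) (charV-suc (suc j))) ⟩
  (a ∷ D) ⊕ scale c (false ∷ (charV (inject₁ j) ⊕ charV (suc j)))
    ≡⟨ cong ((a ∷ D) ⊕_) (scale-∷ c (charV (inject₁ j) ⊕ charV (suc j))) ⟩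
  (a xor false) ∷ (D ⊕ scale c (charV (inject₁ j) ⊕ charV (suc j)))
    ≡⟨ cong₂ _∷_ (xor-identityʳ a) (swapAt-as-⊕ D j) ⟩
  a ∷ swapAt (toℕ j) D ∎
  where
  open ≡-Reasoning
  c = lookup D (inject₁ j) xor lookup D (suc j)
  scale-∷ : ∀ {k} c (v : Vec Bool k) → scale c (false ∷ v) ≡ false ∷ scale c v
  scale-∷ true v = refl
  scale-∷ false v = refl

-- Flipping s_n, in Δ-coordinates.
τ : ∀ {k} → Vec Bool k → Vec Bool k → Vec Bool k
τ P D = D ⊕ scale (dot D P) (complement P)

dot-τ : ∀ {k} (P D : Vec Bool k) → dot (τ P D) P ≡ dot D P
dot-τ P D = begin
  dot (D ⊕ scale (dot D P) (complement P)) P            ≡⟨ dot-⊕ˡ D (scale (dot D P) (complement P)) P ⟩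
  dot D P xor dot (scale (dot D P) (complement P)) P    ≡⟨ cong (dot D P xor_) (dot-scaleˡ (dot D P) (complement P) P) ⟩
  dot D P xor (dot D P ∧ dot (complement P) P)          ≡⟨ cong (λ x → dot D P xor (dot D P ∧ x)) (dot-complement-self P) ⟩
  dot D P xor (dot D P ∧ false)                         ≡⟨ cong (dot D P xor_) (∧-zeroʳ (dot D P)) ⟩
  dot D P xor false                                     ≡⟨ xor-identityʳ _ ⟩
  dot D P ∎
  where open ≡-Reasoning

τ-involutive : ∀ {k} (P D : Vec Bool k) → τ P (τ P D) ≡ D
τ-involutive P D =
  trans (cong (λ c → τ P D ⊕ scale c (complement P)) (dot-τ P D)) (⊕-cancelʳ D (scale (dot D P) (complement P)))

τ-even : ∀ {k} (P D : Vec Bool k) → dot D P ≡ false → τ P D ≡ D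
τ-even P D e = trans (cong (λ c → D ⊕ scale c (complement P)) e) (⊕-identityʳ D)

countIn countOut : ∀ {k} → Vec Bool k → Vec Bool k → ℕ
countIn [] [] = 0
countIn (d ∷ D) (p ∷ P) = bit (d ∧ p) + countIn D P
countOut [] [] = 0
countOut (d ∷ D) (p ∷ P) = bit (d ∧ not p) + countOut D P

weight≡countIn+countOut : ∀ {k} (D P : Vec Bool k) → weight D ≡ countIn D P + countOut D P
weight≡countIn+countOut [] [] = refl
weight≡countIn+countOut (true ∷ D) (true ∷ P) = cong suc (weight≡countIn+countOut D P)
weight≡countIn+countOut (true ∷ D) (false ∷ P) =
  trans (cong suc (weight≡countIn+countOut D P)) (sym (ℕₚ.+-suc (countIn D P) (countOut D P)))
weight≡countIn+countOut (false ∷ D) (true ∷ P) = weight≡countIn+countOut D P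
weight≡countIn+countOut (false ∷ D) (false ∷ P) = weight≡countIn+countOut D P

dot≡isOdd-countIn : ∀ {k} (D P : Vec Bool k) → dot D P ≡ isOdd (countIn D P)
dot≡isOdd-countIn [] [] = refl
dot≡isOdd-countIn (d ∷ D) (p ∷ P) = trans (cong ((d ∧ p) xor_) (dot≡isOdd-countIn D P)) (sym (isOdd-bit+ (d ∧ p) _))

countIn≤weight : ∀ {k} (D P : Vec Bool k) → countIn D P ≤ weight P
countIn≤weight [] [] = z≤n
countIn≤weight (true ∷ D) (true ∷ P) = s≤s (countIn≤weight D P)
countIn≤weight (false ∷ D) (true ∷ P) = ℕₚ.m≤n⇒m≤1+n (countIn≤weight D P)
countIn≤weight (d ∷ D) (false ∷ P) rewrite ∧-zeroʳ d = countIn≤weight D P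

countOut≤weight : ∀ {k} (D P : Vec Bool k) → countOut D P ≤ weight (complement P)
countOut≤weight [] [] = z≤n
countOut≤weight (true ∷ D) (false ∷ P) = s≤s (countOut≤weight D P)
countOut≤weight (false ∷ D) (false ∷ P) = ℕₚ.m≤n⇒m≤1+n (countOut≤weight D P)
countOut≤weight (d ∷ D) (true ∷ P) rewrite ∧-zeroʳ d = countOut≤weight D P

countIn-⊕-complement : ∀ {k} (D P : Vec Bool k) → countIn (D ⊕ complement P) P ≡ countIn D P
countIn-⊕-complement [] [] = refl
countIn-⊕-complement (true ∷ D) (true ∷ P) = cong suc (countIn-⊕-complement D P)
countIn-⊕-complement (false ∷ D) (true ∷ P) = countIn-⊕-complement D P
countIn-⊕-complement (true ∷ D) (false ∷ P) = countIn-⊕-complement D P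
countIn-⊕-complement (false ∷ D) (false ∷ P) = countIn-⊕-complement D P

countOut-⊕-complement : ∀ {k} (D P : Vec Bool k) → countOut (D ⊕ complement P) P + countOut D P ≡ weight (complement P)
countOut-⊕-complement [] [] = refl
countOut-⊕-complement (true ∷ D) (true ∷ P) = countOut-⊕-complement D P
countOut-⊕-complement (false ∷ D) (true ∷ P) = countOut-⊕-complement D P
countOut-⊕-complement (true ∷ D) (false ∷ P) =
  trans (ℕₚ.+-suc (countOut (D ⊕ complement P) P) (countOut D P)) (cong suc (countOut-⊕-complement D P))
countOut-⊕-complement (false ∷ D) (false ∷ P) = cong suc (countOut-⊕-complement D P)

-- On an odd |D ∩ P|, τ keeps D ∩ P and replaces D ∖ P by its complement in ∁P.
weight-τ : ∀ {k} (P D : Vec Bool k) → dot D P ≡ true →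
  weight (τ P D) + countOut D P ≡ countIn D P + weight (complement P)
weight-τ P D odd = begin
  weight (τ P D) + countOut D P
    ≡⟨ cong (λ c → weight (D ⊕ scale c (complement P)) + countOut D P) odd ⟩
  weight (D ⊕ complement P) + countOut D P
    ≡⟨ cong (_+ countOut D P) (weight≡countIn+countOut (D ⊕ complement P) P) ⟩
  (countIn (D ⊕ complement P) P + countOut (D ⊕ complement P) P) + countOut D P
    ≡⟨ ℕₚ.+-assoc (countIn (D ⊕ complement P) P) _ _ ⟩
  countIn (D ⊕ complement P) P + (countOut (D ⊕ complement P) P + countOut D P)
    ≡⟨ cong₂ _+_ (countIn-⊕-complement D P) (countOut-⊕-complement D P) ⟩
  countIn D P + weight (complement P) ∎
  where open ≡-Reasoning

vector-with-counts : ∀ {k} (P : Vec Bool k) a b → a ≤ weight P → b ≤ weight (complement P) →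
  ∃ λ D → countIn D P ≡ a × countOut D P ≡ b
vector-with-counts [] zero zero _ _ = [] , refl , refl
vector-with-counts (true ∷ P) zero b _ b≤ with vector-with-counts P zero b z≤n b≤
... | D , in≡ , out≡ = false ∷ D , in≡ , out≡
vector-with-counts (true ∷ P) (suc a) b (s≤s a≤) b≤ with vector-with-counts P a b a≤ b≤
... | D , in≡ , out≡ = true ∷ D , cong suc in≡ , out≡
vector-with-counts (false ∷ P) a zero a≤ _ with vector-with-counts P a zero a≤ z≤n
... | D , in≡ , out≡ = false ∷ D , in≡ , out≡
vector-with-counts (false ∷ P) a (suc b) a≤ (s≤s b≤) with vector-with-counts P a b a≤ b≤
... | D , in≡ , out≡ = true ∷ D , in≡ , cong suc out≡

data Swaps : ∀ {k} → Vec Bool k → Vec Bool k → Set where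
  done : ∀ {k} {D : Vec Bool k} → Swaps D D
  swap : ∀ {k} {D E : Vec Bool k} (j : ℕ) → suc j < k → Swaps (swapAt j D) E → Swaps D E

Swaps-∷ : ∀ {k} b {D E : Vec Bool k} → Swaps D E → Swaps (b ∷ D) (b ∷ E)
Swaps-∷ b done = done
Swaps-∷ b (swap j j<k r) = swap (suc j) (s≤s j<k) (Swaps-∷ b r)

Swaps-trans : ∀ {k} {D E F : Vec Bool k} → Swaps D E → Swaps E F → Swaps D F
Swaps-trans done r = r
Swaps-trans (swap j j<k r) r′ = swap j j<k (Swaps-trans r r′)

bubble : ∀ k w → w ≤ k → Swaps (false ∷ ones k w) (ones (suc k) w)
bubble k zero _ = done
bubble (suc k) (suc w) (s≤s w≤k) = swap 0 (s≤s (s≤s z≤n)) (Swaps-∷ true (bubble k w w≤k))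

sort : ∀ {k} (D : Vec Bool k) → Swaps D (ones k (weight D))
sort [] = done
sort (true ∷ D) = Swaps-∷ true (sort D)
sort (false ∷ D) = Swaps-trans (Swaps-∷ false (sort D)) (bubble _ (weight D) (weight≤length D))

module Moves {m} (P : Vec Bool (suc m)) where

  infix 4 _∼_
  data _∼_ : Vec Bool (suc m) → Vec Bool (suc m) → Set where
    done : ∀ {D} → D ∼ D
    swap : ∀ {D E} (j : Fin m) → swapAt (toℕ j) D ∼ E → D ∼ E
    flip : ∀ {D E} → τ P D ∼ E → D ∼ E

  ∼-trans : ∀ {D E F} → D ∼ E → E ∼ F → D ∼ F
  ∼-trans done r = r
  ∼-trans (swap j r) r′ = swap j (∼-trans r r′)
  ∼-trans (flip r) r′ = flip (∼-trans r r′)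

  ∼-sym : ∀ {D E} → D ∼ E → E ∼ D
  ∼-sym done = done
  ∼-sym {D} (swap j r) = ∼-trans (∼-sym r) (swap j (subst (_∼ D) (sym (swapAt-involutive (toℕ j) D)) done))
  ∼-sym {D} (flip r) = ∼-trans (∼-sym r) (flip (subst (_∼ D) (sym (τ-involutive P D)) done))

  τ-step : ∀ D → D ∼ τ P D
  τ-step D = flip done

  Swaps⇒∼ : ∀ {D E} → Swaps D E → D ∼ E
  Swaps⇒∼ done = done
  Swaps⇒∼ {D} (swap j j<m r) =
    swap (fromℕ< (ℕ.s<s⁻¹ j<m)) (subst (λ t → swapAt t D ∼ _) (sym (toℕ-fromℕ< (ℕ.s<s⁻¹ j<m))) (Swaps⇒∼ r))

  ∼-ones : ∀ D → D ∼ ones (suc m) (weight D)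
  ∼-ones D = Swaps⇒∼ (sort D)

  same-weight⇒∼ : ∀ D E → weight D ≡ weight E → D ∼ E
  same-weight⇒∼ D E w≡ = ∼-trans (∼-ones D) (subst (λ w → ones (suc m) w ∼ E) (sym w≡) (∼-sym (∼-ones E)))

  ∼-preserves : (Q : ℕ → Set) → (∀ D → dot D P ≡ true → Q (weight D) → Q (weight (τ P D))) →
    ∀ {D E} → D ∼ E → Q (weight D) → Q (weight E)
  ∼-preserves Q τ-closed done q = q
  ∼-preserves Q τ-closed {D} (swap j r) q = ∼-preserves Q τ-closed r (subst Q (sym (weight-swapAt (toℕ j) D)) q)
  ∼-preserves Q τ-closed {D} (flip r) q = ∼-preserves Q τ-closed r (τ-preserves (dot D P) refl)
    where
    τ-preserves : ∀ c → dot D P ≡ c → Q (weight (τ P D))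
    τ-preserves true odd = τ-closed D odd q
    τ-preserves false even = subst (λ X → Q (weight X)) (sym (τ-even P D even)) q

  τ-link : ∀ a b → a ≤ weight P → b ≤ weight (complement P) → isOdd a ≡ true →
    ∃ λ D → weight D ≡ a + b × weight (τ P D) + b ≡ a + weight (complement P) × dot D P ≡ true
  τ-link a b a≤ b≤ a-odd with vector-with-counts P a b a≤ b≤
  ... | D , in≡ , out≡ =
    D , trans (weight≡countIn+countOut D P) (cong₂ _+_ in≡ out≡) ,
    subst₂ (λ x y → weight (τ P D) + y ≡ x + weight (complement P)) in≡ out≡ (weight-τ P D odd) , odd
    where
    odd : dot D P ≡ true
    odd = trans (dot≡isOdd-countIn D P) (trans (cong isOdd in≡) a-odd)

  linked-weights-∼ : ∀ X {w₁ w₂} → weight X ≡ w₁ → weight (τ P X) ≡ w₂ →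
    ∀ D E → (weight D ≡ w₁ ⊎ weight D ≡ w₂) → (weight E ≡ w₁ ⊎ weight E ≡ w₂) → D ∼ E
  linked-weights-∼ X e₁ e₂ D E (inj₁ a) (inj₁ b) = same-weight⇒∼ D E (trans a (sym b))
  linked-weights-∼ X e₁ e₂ D E (inj₂ a) (inj₂ b) = same-weight⇒∼ D E (trans a (sym b))
  linked-weights-∼ X e₁ e₂ D E (inj₁ a) (inj₂ b) =
    ∼-trans (same-weight⇒∼ D X (trans a (sym e₁))) (∼-trans (τ-step X) (same-weight⇒∼ (τ P X) E (trans e₂ (sym b))))
  linked-weights-∼ X e₁ e₂ D E (inj₂ a) (inj₁ b) =
    ∼-trans (same-weight⇒∼ D (τ P X) (trans a (sym e₂))) (∼-trans (∼-sym (τ-step X)) (same-weight⇒∼ X E (trans e₁ (sym b))))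

-- The graph S in Δ-coordinates

≡ᵇ-true : ∀ a b → (a ≡ᵇ b) ≡ true → a ≡ b
≡ᵇ-true a b e = ℕₚ.≡ᵇ⇒≡ a b (subst T (sym e) _)

≡ᵇ-false : ∀ a b → (a ≡ᵇ b) ≡ false → a ≢ b
≡ᵇ-false a b e a≡b = subst T e (ℕₚ.≡⇒≡ᵇ a b a≡b)

≡ᵇ-self-xor-suc : ∀ i → ((i ≡ᵇ i) xor (suc i ≡ᵇ i)) ≡ true
≡ᵇ-self-xor-suc zero = refl
≡ᵇ-self-xor-suc (suc i) = ≡ᵇ-self-xor-suc i

no-2-cycle : ∀ (a : ℕ) → suc (suc a) ≢ a
no-2-cycle (suc a) e = no-2-cycle a (ℕₚ.suc-injective e)

adjacency-bit : ∀ (x : Bool) a b →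
  (x ≡ true → suc a ≡ b ⊎ suc b ≡ a) → (suc a ≡ b ⊎ suc b ≡ a → x ≡ true) →
  x ≡ ((suc a ≡ᵇ b) xor (suc b ≡ᵇ a))
adjacency-bit x a b only-if if with suc a ≡ᵇ b in e₁ | suc b ≡ᵇ a in e₂
... | true | true with () ← no-2-cycle a (trans (cong suc (≡ᵇ-true _ _ e₁)) (≡ᵇ-true _ _ e₂))
... | true | false = if (inj₁ (≡ᵇ-true _ _ e₁))
... | false | true = if (inj₂ (≡ᵇ-true _ _ e₂))
... | false | false with x in ex
...   | false = refl
...   | true with only-if refl
...     | inj₁ e = ⊥-elim (≡ᵇ-false _ _ e₁ e)
...     | inj₂ e = ⊥-elim (≡ᵇ-false _ _ e₂ e)

-- The path-coordinates of \overline{i+2} are those of \overline{i+1} shifted by one place.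
path-coordinate-step : ∀ (j i : ℕ) →
  (((j ≡ᵇ i) xor (suc j ≡ᵇ i)) xor ((suc j ≡ᵇ i) xor (suc i ≡ᵇ j))) ≡ ((j ≡ᵇ suc i) xor (j ≡ᵇ i))
path-coordinate-step zero zero = refl
path-coordinate-step zero (suc zero) = refl
path-coordinate-step zero (suc (suc i)) = refl
path-coordinate-step (suc zero) zero = refl
path-coordinate-step (suc (suc j)) zero = refl
path-coordinate-step (suc j) (suc i) = path-coordinate-step j i

length-filter-filter : ∀ {A : Set} {p q : A → Set} (p? : ∀ x → Dec (p x)) (q? : ∀ x → Dec (q x)) (xs : List A) →
  List.length (List.filter p? (List.filter q? xs)) ≡ ListAction.sum (List.map (λ x → bit (does (p? x) ∧ does (q? x))) xs)
length-filter-filter p? q? List.[] = refl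
length-filter-filter p? q? (x List.∷ xs) with does (q? x)
... | false = trans (length-filter-filter p? q? xs) (cong (λ b → bit b + _) (sym (∧-zeroʳ (does (p? x)))))
... | true with does (p? x)
...   | true = cong suc (length-filter-filter p? q? xs)
...   | false = length-filter-filter p? q? xs

sum-bits-below : ∀ {k} i (f : Fin k → Bool) →
  ListAction.sum (List.tabulate (λ x → bit (does (toℕ x ℕₚ.<? i) ∧ does (f x Boolₚ.≟ true)))) ≡ countPrefix i (tabulate f)
sum-bits-below {zero} zero f = refl
sum-bits-below {zero} (suc i) f = refl
sum-bits-below {suc k} zero f = sum-bits-below {k} zero (λ x → f (suc x))
sum-bits-below {suc k} (suc i) f = cong₂ _+_ (cong bit (does-≟-true (f zero))) (sum-bits-below i (λ x → f (suc x)))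
  where
  does-≟-true : ∀ b → does (b Boolₚ.≟ true) ≡ b
  does-≟-true true = refl
  does-≟-true false = refl

module PathGraph {m} (adj : Adj (suc m)) (simple : IsSimple adj) (path : InducedPathPrefix adj) where

  n : ℕ
  n = suc m

  P : Vec Bool n
  P = tabulate (InΠ₁ adj)

  open Moves P public

  irreflexive : ∀ a → adj a a ≡ false
  irreflexive = proj₂ simple

  path-adjacency : ∀ (j j′ : Fin m) →
    adj (inject₁ j) (inject₁ j′) ≡ ((suc (toℕ j) ≡ᵇ toℕ j′) xor (suc (toℕ j′) ≡ᵇ toℕ j))
  path-adjacency j j′ with path (inject₁ j) (inject₁ j′) (inject₁ℕ< j) (inject₁ℕ< j′)
  ... | only-if , if rewrite toℕ-inject₁ j | toℕ-inject₁ j′ = adjacency-bit _ _ _ only-if if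

  lookup-flipMove-· : ∀ s (u : F2 n) a → lookup (flipMove adj s · u) a ≡ (lookup u a xor (lookup u s ∧ adj a s))
  lookup-flipMove-· s u a = begin
    lookup (flipMove adj s · u) a
      ≡⟨ cong (λ v → lookup v a) (flipMove-· adj irreflexive s u) ⟩
    lookup (u ⊕ scale (lookup u s) (column adj s)) a
      ≡⟨ lookup-⊕ u (scale (lookup u s) (column adj s)) a ⟩
    lookup u a xor lookup (scale (lookup u s) (column adj s)) a
      ≡⟨ cong (lookup u a xor_) (trans (lookup-scale (lookup u s) (column adj s) a)
                                       (cong (lookup u s ∧_) (lookup∘tabulate (λ x → adj x s) a))) ⟩
    lookup u a xor (lookup u s ∧ adj a s) ∎
    where open ≡-Reasoning

  -- On the path, \overline{i+1} = e_{s_i} + e_{s_{i+1}} (with e_{s_0} = 0).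
  lookup-barN-path : ∀ i (i<n : i < n) (j : Fin m) →
    lookup (barN adj i i<n) (inject₁ j) ≡ ((toℕ j ≡ᵇ i) xor (suc (toℕ j) ≡ᵇ i))
  lookup-barN-path zero _ zero = refl
  lookup-barN-path zero _ (suc j) = lookup-charV zero (inject₁ (suc j))
  lookup-barN-path (suc i) i+1<n j = begin
    lookup (flipMove adj s · b) (inject₁ j)
      ≡⟨ lookup-flipMove-· s b (inject₁ j) ⟩
    lookup b (inject₁ j) xor (lookup b s ∧ adj (inject₁ j) s)
      ≡⟨ cong (λ t → lookup b (inject₁ j) xor (lookup b t ∧ adj (inject₁ j) t)) s≡ ⟩
    lookup b (inject₁ j) xor (lookup b (inject₁ j₀) ∧ adj (inject₁ j) (inject₁ j₀))
      ≡⟨ cong₂ (λ x y → lookup b (inject₁ j) xor (x ∧ y)) b-at-s (path-adjacency j j₀) ⟩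
    lookup b (inject₁ j) xor ((suc (toℕ j) ≡ᵇ toℕ j₀) xor (suc (toℕ j₀) ≡ᵇ toℕ j))
      ≡⟨ cong₂ (λ x y → x xor ((suc (toℕ j) ≡ᵇ y) xor (suc y ≡ᵇ toℕ j))) (lookup-barN-path i i<n j) toℕj₀ ⟩
    ((toℕ j ≡ᵇ i) xor (suc (toℕ j) ≡ᵇ i)) xor ((suc (toℕ j) ≡ᵇ i) xor (suc i ≡ᵇ toℕ j))
      ≡⟨ path-coordinate-step (toℕ j) i ⟩
    (toℕ j ≡ᵇ suc i) xor (toℕ j ≡ᵇ i) ∎
    where
    open ≡-Reasoning
    i<n : i < n
    i<n = ℕₚ.m<n⇒m<1+n (ℕ.s<s⁻¹ i+1<n)
    s = fromℕ< i<n
    b = barN adj i i<n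
    j₀ : Fin m
    j₀ = fromℕ< (ℕ.s<s⁻¹ i+1<n)
    toℕj₀ : toℕ j₀ ≡ i
    toℕj₀ = toℕ-fromℕ< (ℕ.s<s⁻¹ i+1<n)
    s≡ : s ≡ inject₁ j₀
    s≡ = toℕ-injective (trans (toℕ-fromℕ< i<n) (sym (trans (toℕ-inject₁ j₀) toℕj₀)))
    b-at-s : lookup b (inject₁ j₀) ≡ true
    b-at-s = trans (lookup-barN-path i i<n j₀)
                   (subst (λ t → ((t ≡ᵇ i) xor (suc t ≡ᵇ i)) ≡ true) (sym toℕj₀)
                          (≡ᵇ-self-xor-suc i))

  bar≡fromΔ-charV : ∀ k → bar adj k ≡ fromΔ P (charV k)
  bar≡fromΔ-charV k = lookup-ext-∷ʳ _ _ on-path on-s-n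
    where
    on-path : ∀ j → lookup (bar adj k) (inject₁ j) ≡ lookup (fromΔ P (charV k)) (inject₁ j)
    on-path j = begin
      lookup (bar adj k) (inject₁ j)
        ≡⟨ lookup-barN-path (toℕ k) (toℕ<n k) j ⟩
      (toℕ j ≡ᵇ toℕ k) xor (suc (toℕ j) ≡ᵇ toℕ k)
        ≡⟨ cong (λ t → (t ≡ᵇ toℕ k) xor (suc (toℕ j) ≡ᵇ toℕ k)) (sym (toℕ-inject₁ j)) ⟩
      (toℕ (inject₁ j) ≡ᵇ toℕ k) xor (toℕ (suc j) ≡ᵇ toℕ k)
        ≡⟨ sym (cong₂ _xor_ (trans (lookup-charV k (inject₁ j)) (≟-toℕ (inject₁ j) k))
                             (trans (lookup-charV k (suc j)) (≟-toℕ (suc j) k))) ⟩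
      lookup (charV k) (inject₁ j) xor lookup (charV k) (suc j)
        ≡⟨ sym (lookup-fromΔ-inject₁ P (charV k) j) ⟩
      lookup (fromΔ P (charV k)) (inject₁ j) ∎
      where open ≡-Reasoning
    on-s-n : lookup (bar adj k) (fromℕ m) ≡ lookup (fromΔ P (charV k)) (fromℕ m)
    on-s-n = begin
      lookup (bar adj k) (fromℕ m)      ≡⟨ sym (⟨,charV⟩ (bar adj k) (fromℕ m)) ⟩
      InΠ₁ adj k                         ≡⟨ sym (lookup∘tabulate (InΠ₁ adj) k) ⟩
      lookup P k                         ≡⟨ sym (dot-charVˡ P k) ⟩
      dot (charV k) P                    ≡⟨ sym (lookup-fromΔ-last P (charV k)) ⟩
      lookup (fromΔ P (charV k)) (fromℕ m) ∎
      where open ≡-Reasoning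

  sumSubset≡fromΔ : ∀ D → sumSubset adj D ≡ fromΔ P D
  sumSubset≡fromΔ D = begin
    List.foldr _⊕_ zeroV (List.map (λ k → if lookup D k then bar adj k else zeroV) (List.allFin n))
      ≡⟨ cong (List.foldr _⊕_ zeroV) (map-cong summand (List.allFin n)) ⟩
    List.foldr _⊕_ zeroV (List.map (λ k → fromΔ P (scale (lookup D k) (charV k))) (List.allFin n))
      ≡⟨ fromΔ-foldr-⊕ P (λ k → scale (lookup D k) (charV k)) (List.allFin n) ⟩
    fromΔ P (List.foldr _⊕_ zeroV (List.map (λ k → scale (lookup D k) (charV k)) (List.allFin n)))
      ≡⟨ cong (fromΔ P) (sum-charV D) ⟩
    fromΔ P D ∎
    where
    open ≡-Reasoning
    summand : ∀ k → (if lookup D k then bar adj k else zeroV) ≡ fromΔ P (scale (lookup D k) (charV k))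
    summand k with lookup D k
    ... | true = bar≡fromΔ-charV k
    ... | false = sym (fromΔ-zeroV P)

  -- Flipping s_{j+1} (a path vertex) adds \overline{j+1} + \overline{j+2}.
  column-path≡fromΔ : ∀ (j : Fin m) → column adj (inject₁ j) ≡ fromΔ P (charV (inject₁ j) ⊕ charV (suc j))
  column-path≡fromΔ j = begin
    column adj (inject₁ j)                          ≡⟨ sym (⊕-cancelˡ b (column adj (inject₁ j))) ⟩
    b ⊕ (b ⊕ column adj (inject₁ j))                ≡⟨ cong (b ⊕_) (sym next-bar) ⟩
    b ⊕ bar adj (suc j)                             ≡⟨ cong₂ _⊕_ (trans b≡bar (bar≡fromΔ-charV (inject₁ j))) (bar≡fromΔ-charV (suc j)) ⟩
    fromΔ P (charV (inject₁ j)) ⊕ fromΔ P (charV (suc j)) ≡⟨ sym (fromΔ-⊕ P (charV (inject₁ j)) (charV (suc j))) ⟩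
    fromΔ P (charV (inject₁ j) ⊕ charV (suc j)) ∎
    where
    open ≡-Reasoning
    j<n : toℕ j < n
    j<n = ℕₚ.m<n⇒m<1+n (ℕ.s<s⁻¹ (toℕ<n (suc j)))
    b = barN adj (toℕ j) j<n
    s≡ : fromℕ< j<n ≡ inject₁ j
    s≡ = toℕ-injective (trans (toℕ-fromℕ< j<n) (sym (toℕ-inject₁ j)))
    b-at-s : lookup b (inject₁ j) ≡ true
    b-at-s = trans (lookup-barN-path (toℕ j) j<n j) (≡ᵇ-self-xor-suc (toℕ j))
    next-bar : bar adj (suc j) ≡ b ⊕ column adj (inject₁ j)
    next-bar = trans (flipMove-· adj irreflexive (fromℕ< j<n) b)
      (trans (cong (λ t → b ⊕ scale (lookup b t) (column adj t)) s≡)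
             (cong (λ x → b ⊕ scale x (column adj (inject₁ j))) b-at-s))
    b≡bar : b ≡ bar adj (inject₁ j)
    b≡bar = barN-cong (sym (toℕ-inject₁ j))
      where
      barN-cong : ∀ {i i′} {p : i < n} {p′ : i′ < n} → i ≡ i′ → barN adj i p ≡ barN adj i′ p′
      barN-cong {i} {p = p} {p′} refl = cong (barN adj i) (ℕₚ.≤-irrelevant p p′)

  -- Flipping s_n adds Σ_{k ∉ Π₁} \overline{k}.
  column-last≡fromΔ : column adj (fromℕ m) ≡ fromΔ P (complement P)
  column-last≡fromΔ = lookup-ext-∷ʳ _ _ on-path on-s-n
    where
    on-path : ∀ j → lookup (column adj (fromℕ m)) (inject₁ j) ≡ lookup (fromΔ P (complement P)) (inject₁ j)
    on-path j = begin
      lookup (column adj (fromℕ m)) (inject₁ j)         ≡⟨ lookup∘tabulate (λ a → adj a (fromℕ m)) (inject₁ j) ⟩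
      adj (inject₁ j) (fromℕ m)                         ≡⟨ proj₁ simple _ _ ⟩
      adj (fromℕ m) (inject₁ j)                         ≡⟨ sym (lookup∘tabulate (λ a → adj a (inject₁ j)) (fromℕ m)) ⟩
      lookup (column adj (inject₁ j)) (fromℕ m)         ≡⟨ cong (λ v → lookup v (fromℕ m)) (column-path≡fromΔ j) ⟩
      lookup (fromΔ P E) (fromℕ m)                      ≡⟨ lookup-fromΔ-last P E ⟩
      dot E P                                           ≡⟨ dot-⊕ˡ (charV (inject₁ j)) (charV (suc j)) P ⟩
      dot (charV (inject₁ j)) P xor dot (charV (suc j)) P ≡⟨ cong₂ _xor_ (dot-charVˡ P (inject₁ j)) (dot-charVˡ P (suc j)) ⟩
      lookup P (inject₁ j) xor lookup P (suc j)         ≡⟨ sym (xor-annihilates-not (lookup P (inject₁ j)) (lookup P (suc j))) ⟩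
      not (lookup P (inject₁ j)) xor not (lookup P (suc j))
        ≡⟨ sym (cong₂ _xor_ (lookup-map (inject₁ j) not P) (lookup-map (suc j) not P)) ⟩
      lookup (complement P) (inject₁ j) xor lookup (complement P) (suc j)
        ≡⟨ sym (lookup-fromΔ-inject₁ P (complement P) j) ⟩
      lookup (fromΔ P (complement P)) (inject₁ j) ∎
      where
      open ≡-Reasoning
      E = charV (inject₁ j) ⊕ charV (suc j)
    on-s-n : lookup (column adj (fromℕ m)) (fromℕ m) ≡ lookup (fromΔ P (complement P)) (fromℕ m)
    on-s-n = trans (lookup∘tabulate (λ a → adj a (fromℕ m)) (fromℕ m))
               (trans (irreflexive (fromℕ m)) (sym (trans (lookup-fromΔ-last P (complement P)) (dot-complement-self P))))

  flipMove-path : ∀ (j : Fin m) D → flipMove adj (inject₁ j) · fromΔ P D ≡ fromΔ P (swapAt (toℕ j) D)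
  flipMove-path j D = begin
    flipMove adj (inject₁ j) · fromΔ P D
      ≡⟨ flipMove-· adj irreflexive (inject₁ j) (fromΔ P D) ⟩
    fromΔ P D ⊕ scale (lookup (fromΔ P D) (inject₁ j)) (column adj (inject₁ j))
      ≡⟨ cong₂ (λ x y → fromΔ P D ⊕ scale x y) (lookup-fromΔ-inject₁ P D j) (column-path≡fromΔ j) ⟩
    fromΔ P D ⊕ scale c (fromΔ P E)  ≡⟨ cong (fromΔ P D ⊕_) (sym (fromΔ-scale P c E)) ⟩
    fromΔ P D ⊕ fromΔ P (scale c E)  ≡⟨ sym (fromΔ-⊕ P D (scale c E)) ⟩
    fromΔ P (D ⊕ scale c E)          ≡⟨ cong (fromΔ P) (swapAt-as-⊕ D j) ⟩
    fromΔ P (swapAt (toℕ j) D) ∎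
    where
    open ≡-Reasoning
    E = charV (inject₁ j) ⊕ charV (suc j)
    c = lookup D (inject₁ j) xor lookup D (suc j)

  flipMove-last : ∀ D → flipMove adj (fromℕ m) · fromΔ P D ≡ fromΔ P (τ P D)
  flipMove-last D = begin
    flipMove adj (fromℕ m) · fromΔ P D
      ≡⟨ flipMove-· adj irreflexive (fromℕ m) (fromΔ P D) ⟩
    fromΔ P D ⊕ scale (lookup (fromΔ P D) (fromℕ m)) (column adj (fromℕ m))
      ≡⟨ cong₂ (λ x y → fromΔ P D ⊕ scale x y) (lookup-fromΔ-last P D) column-last≡fromΔ ⟩
    fromΔ P D ⊕ scale (dot D P) (fromΔ P (complement P))
      ≡⟨ cong (fromΔ P D ⊕_) (sym (fromΔ-scale P (dot D P) (complement P))) ⟩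
    fromΔ P D ⊕ fromΔ P (scale (dot D P) (complement P))
      ≡⟨ sym (fromΔ-⊕ P D (scale (dot D P) (complement P))) ⟩
    fromΔ P (τ P D) ∎
    where open ≡-Reasoning

  prepend : ∀ {v D X} → (∀ {E} → X ∼ E → D ∼ E) → (∃ λ E → v ≡ fromΔ P E × X ∼ E) → ∃ λ E → v ≡ fromΔ P E × D ∼ E
  prepend extend (E , v≡ , X∼E) = E , v≡ , extend X∼E

  ∼⇒SameOrbit : ∀ {D E} → D ∼ E → SameOrbit adj (fromΔ P D) (fromΔ P E)
  ∼⇒SameOrbit done = done
  ∼⇒SameOrbit {D} (swap j r) = move (inject₁ j) (subst (λ u → SameOrbit adj u _) (sym (flipMove-path j D)) (∼⇒SameOrbit r))
  ∼⇒SameOrbit {D} (flip r) = move (fromℕ m) (subst (λ u → SameOrbit adj u _) (sym (flipMove-last D)) (∼⇒SameOrbit r))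

  SameOrbit⇒∼ : ∀ {u v} → SameOrbit adj u v → ∀ D → u ≡ fromΔ P D → ∃ λ E → v ≡ fromΔ P E × D ∼ E
  SameOrbit⇒∼ done D u≡ = D , u≡ , done
  SameOrbit⇒∼ (move s r) D u≡ with injectOrLast s
  ... | inject j = prepend (swap j) (SameOrbit⇒∼ r (swapAt (toℕ j) D) (trans (cong (flipMove adj (inject₁ j) ·_) u≡) (flipMove-path j D)))
  ... | last = prepend flip (SameOrbit⇒∼ r (τ P D) (trans (cong (flipMove adj (fromℕ m) ·_) u≡) (flipMove-last D)))

  countΠ₁upTo≡countPrefix : ∀ i → countΠ₁upTo adj i ≡ countPrefix i P
  countΠ₁upTo≡countPrefix i =
    trans (length-filter-filter (λ k → toℕ k ℕₚ.<? i) (λ k → InΠ₁ adj k Boolₚ.≟ true) (List.allFin n))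
          (trans (cong ListAction.sum (map-tabulate (λ x → x) (λ x → bit (does (toℕ x ℕₚ.<? i) ∧ does (InΠ₁ adj x Boolₚ.≟ true)))))
                 (sum-bits-below i (InΠ₁ adj)))

  sizeΠ₁≡weight : sizeΠ₁ adj ≡ weight P
  sizeΠ₁≡weight = trans (countΠ₁upTo≡countPrefix n) (countPrefix-all P)

  InI⇒InIᴾ : ∀ {i} → InI adj i → InIᴾ P i
  InI⇒InIᴾ {i} (1≤i , i≤n , inj₁ even) = 1≤i , i≤n , inj₁ (subst Even (countΠ₁upTo≡countPrefix i) even)
  InI⇒InIᴾ {i} (1≤i , i≤n , inj₂ (inj₁ i≡n)) = 1≤i , i≤n , inj₂ (inj₁ i≡n)
  InI⇒InIᴾ {i} (1≤i , i≤n , inj₂ (inj₂ odd)) = 1≤i , i≤n , inj₂ (inj₂ (subst Odd (countΠ₁upTo≡countPrefix (n ∸ i)) odd))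

  InIᴾ⇒InI : ∀ {i} → InIᴾ P i → InI adj i
  InIᴾ⇒InI {i} (1≤i , i≤n , inj₁ even) = 1≤i , i≤n , inj₁ (subst Even (sym (countΠ₁upTo≡countPrefix i)) even)
  InIᴾ⇒InI {i} (1≤i , i≤n , inj₂ (inj₁ i≡n)) = 1≤i , i≤n , inj₂ (inj₁ i≡n)
  InIᴾ⇒InI {i} (1≤i , i≤n , inj₂ (inj₂ odd)) = 1≤i , i≤n , inj₂ (inj₂ (subst Odd (sym (countΠ₁upTo≡countPrefix (n ∸ i))) odd))

-- Orbits when |Π₁| is odd

module OddΠ₁ {m} (adj : Adj (suc m)) (simple : IsSimple adj) (path : InducedPathPrefix adj)
             (Π₁-odd : Odd (sizeΠ₁ adj)) where

  open PathGraph adj simple path public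

  P-odd : isOdd (weight P) ≡ true
  P-odd = Odd⇒isOdd (weight P) (subst Odd sizeΠ₁≡weight Π₁-odd)

  open OddWeight P P-odd public hiding (n)

  InI? : ∀ i → Dec (InI adj i)
  InI? i = (1 ℕₚ.≤? i) ×-dec (i ℕₚ.≤? n) ×-dec
           ((countΠ₁upTo adj i ℕ.% 2 ℕₚ.≟ 0) ⊎-dec (i ℕₚ.≟ n) ⊎-dec (countΠ₁upTo adj (n ∸ i) ℕ.% 2 ℕₚ.≟ 1))

  1≤weight-fromΔ : ∀ D → 1 ≤ weight D → 1 ≤ weight (fromΔ P D)
  1≤weight-fromΔ D 1≤w with weight (fromΔ P D) in e
  ... | suc _ = s≤s z≤n
  ... | zero with refl ← weight-fromΔ≡0 D e = ⊥-elim (ℕₚ.<-irrefl (sym (weight-zeroV n)) 1≤w)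

  odd-dot⇒nonzero : ∀ D → dot D P ≡ true → 1 ≤ weight D
  odd-dot⇒nonzero D odd with weight D in e
  ... | suc _ = s≤s z≤n
  ... | zero with () ← trans (sym odd) (trans (cong (λ X → dot X P) (weight≡0⇒zeroV D e)) (dot-zeroVˡ P))

  1≤weight-τ : ∀ D → dot D P ≡ true → 1 ≤ weight D → 1 ≤ weight (τ P D)
  1≤weight-τ D odd _ = odd-dot⇒nonzero (τ P D) (trans (dot-τ P D) odd)

  ≡0-τ-closed : ∀ D → dot D P ≡ true → weight D ≡ 0 → weight (τ P D) ≡ 0
  ≡0-τ-closed D odd w≡0 = ⊥-elim (ℕₚ.<-irrefl (sym w≡0) (odd-dot⇒nonzero D odd))

  nonzero-orbit : ∀ D → 1 ≤ weight D → ∀ v → SameOrbit adj (fromΔ P D) v → 1 ≤ weight v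
  nonzero-orbit D 1≤w v D~v with SameOrbit⇒∼ D~v D refl
  ... | E , refl , D∼E = 1≤weight-fromΔ E (∼-preserves (1 ≤_) 1≤weight-τ D∼E 1≤w)

  1≤weight-preimage : ∀ u → u ≢ zeroV → ∀ D → fromΔ P D ≡ u → 1 ≤ weight D
  1≤weight-preimage u u≢0 D e with weight D in w
  ... | suc _ = s≤s z≤n
  ... | zero = ⊥-elim (u≢0 (trans (sym e) (trans (cong (fromΔ P) (weight≡0⇒zeroV D w)) (fromΔ-zeroV P))))

  InUT⇒fromΔ : ∀ Q {u} → InUT adj Q u → ∃ λ D → fromΔ P D ≡ u × Q (weight D)
  InUT⇒fromΔ Q (D , e , q) = D , trans (sym (sumSubset≡fromΔ D)) e , q

  fromΔ∈InUT : ∀ Q D → Q (weight D) → InUT adj Q (fromΔ P D)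
  fromΔ∈InUT Q D q = D , sumSubset≡fromΔ D , q

  ones-representative : ∀ D → SameOrbit adj (fromΔ P D) (fromΔ P (ones n (weight D)))
  ones-representative D = ∼⇒SameOrbit (∼-ones D)

  orbit-weight≤2 : ∀ u k → OrbitWeight adj u k → k ≤ 2
  orbit-weight≤2 u k (_ , minimal) with fromΔ-surjective u
  ... | D , refl = ℕₚ.≤-trans (minimal _ (ones-representative D)) (weight-fromΔ-ones≤2 P (weight D))

  M≡1 : (∀ D → 1 ≤ weight D → ∃ λ v → SameOrbit adj (fromΔ P D) v × weight v ≡ 1) → IsMaxWeight adj 1
  M≡1 reaches-1 = (fromΔ P allOnes , weight-1-orbit) , at-most-1
    where
    weight-1-orbit : OrbitWeight adj (fromΔ P allOnes) 1
    weight-1-orbit with InIᴾ⇒weight-fromΔ≡1 n (s≤s z≤n , ℕₚ.≤-refl , inj₂ (inj₁ refl))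
    ... | D , w≡n , w≡1 =
      (fromΔ P D , ∼⇒SameOrbit (same-weight⇒∼ allOnes D (trans (weight-allOnes n) (sym w≡n))) , w≡1) ,
      nonzero-orbit allOnes (subst (1 ≤_) (sym (weight-allOnes n)) (s≤s z≤n))
    at-most-1 : ∀ u k → OrbitWeight adj u k → k ≤ 1
    at-most-1 u k (_ , minimal) with fromΔ-surjective u
    ... | D , refl with weight D in w
    ...   | suc _ with reaches-1 D (subst (1 ≤_) (sym w) (s≤s z≤n))
    ...     | v , D~v , v≡1 = subst (k ≤_) v≡1 (minimal v D~v)
    at-most-1 u k (_ , minimal) | D , refl | zero with refl ← weight≡0⇒zeroV D w =
      ℕₚ.≤-trans (minimal (fromΔ P zeroV) done) (ℕₚ.≤-trans (ℕₚ.≤-reflexive (trans (cong weight (fromΔ-zeroV P)) (weight-zeroV n))) z≤n)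

  M≢1 : (∃ λ u → OrbitWeight adj u 2) → ¬ IsMaxWeight adj 1
  M≢1 (u , weight-2) (_ , at-most-1) with s≤s () ← at-most-1 u 2 weight-2

  ∼-from-SameOrbit : ∀ {D E} → SameOrbit adj (fromΔ P D) (fromΔ P E) → D ∼ E
  ∼-from-SameOrbit {D} {E} D~E with SameOrbit⇒∼ D~E D refl
  ... | F , e , D∼F = subst (D ∼_) (sym (fromΔ-injective E F e)) D∼F

  module WeightClass (Q : ℕ → Set)
                     (τ-closed : ∀ D → dot D P ≡ true → Q (weight D) → Q (weight (τ P D)))
                     (connected : ∀ D E → Q (weight D) → Q (weight E) → D ∼ E)
                     (positive : ∀ k → Q k → 1 ≤ k) where

    ∼-Q : ∀ {D E} → D ∼ E → Q (weight D) → Q (weight E)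
    ∼-Q = ∼-preserves Q τ-closed

    isOrbit : (∃ λ k → Q k × k ≤ n) → IsOrbit adj (InUT adj Q)
    isOrbit (k , q , k≤n) =
      (fromΔ P (ones n k) , fromΔ∈InUT Q (ones n k) (subst Q (sym (weight-ones n k k≤n)) q)) ,
      (λ u v u∈ v∈ → same-orbit (InUT⇒fromΔ Q u∈) (InUT⇒fromΔ Q v∈)) ,
      (λ u v u∈ u~v → closed (InUT⇒fromΔ Q u∈) u~v)
      where
      same-orbit : ∀ {u v} → (∃ λ D → fromΔ P D ≡ u × Q (weight D)) → (∃ λ E → fromΔ P E ≡ v × Q (weight E)) →
        SameOrbit adj u v
      same-orbit (D , refl , qD) (E , refl , qE) = ∼⇒SameOrbit (connected D E qD qE)
      closed : ∀ {u v} → (∃ λ D → fromΔ P D ≡ u × Q (weight D)) → SameOrbit adj u v → InUT adj Q v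
      closed (D , refl , qD) u~v with SameOrbit⇒∼ u~v D refl
      ... | E , refl , D∼E = fromΔ∈InUT Q E (∼-Q D∼E qD)

    weight-1 : ∀ D → Q (weight D) → (∃ λ k → Q k × InI adj k) → OrbitWeight adj (fromΔ P D) 1
    weight-1 D qD (k , qk , k∈I) with InIᴾ⇒weight-fromΔ≡1 k (InI⇒InIᴾ k∈I)
    ... | X , w≡k , w≡1 =
      (fromΔ P X , ∼⇒SameOrbit (connected D X qD (subst Q (sym w≡k) qk)) , w≡1) , nonzero-orbit D (positive _ qD)

    ≥2-outside-I : (∀ k → Q k → ¬ InI adj k) → ∀ E → Q (weight E) → 2 ≤ weight (fromΔ P E)
    ≥2-outside-I ∉I E qE with weight (fromΔ P E) in e
    ... | suc (suc _) = s≤s (s≤s z≤n)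
    ... | suc zero = ⊥-elim (∉I _ qE (InIᴾ⇒InI (weight-fromΔ≡1⇒InIᴾ E e)))
    ... | zero with refl ← weight-fromΔ≡0 E e = ⊥-elim (ℕₚ.<-irrefl (sym (weight-zeroV n)) (positive _ qE))

    weight-2 : ∀ D → Q (weight D) → (∀ k → Q k → ¬ InI adj k) → OrbitWeight adj (fromΔ P D) 2
    weight-2 D qD ∉I =
      (fromΔ P (ones n (weight D)) , ones-representative D ,
       ℕₚ.≤-antisym (weight-fromΔ-ones≤2 P (weight D)) (≥2-outside-I ∉I (ones n (weight D)) (subst Q (sym w≡) qD))) ,
      λ v D~v → at-least-2 v D~v
      where
      w≡ : weight (ones n (weight D)) ≡ weight D
      w≡ = weight-ones n (weight D) (weight≤length D)
      at-least-2 : ∀ v → SameOrbit adj (fromΔ P D) v → 2 ≤ weight v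
      at-least-2 v D~v with SameOrbit⇒∼ D~v D refl
      ... | E , refl , D∼E = ≥2-outside-I ∉I E (∼-Q D∼E qD)

  -- Classes Q 1, …, Q c partitioning the weights 1, …, n; with {0} they give all orbits.
  module Partition (c : ℕ) (Q : ℕ → ℕ → Set) (Q? : ∀ i k → Dec (Q i k))
    (τ-closed : ∀ i → 1 ≤ i → i ≤ c → ∀ D → dot D P ≡ true → Q i (weight D) → Q i (weight (τ P D)))
    (connected : ∀ i → 1 ≤ i → i ≤ c → ∀ D E → Q i (weight D) → Q i (weight E) → D ∼ E)
    (positive : ∀ i → 1 ≤ i → i ≤ c → ∀ k → Q i k → 1 ≤ k)
    (representative : ∀ i → 1 ≤ i → i ≤ c → ∃ λ k → Q i k × k ≤ n)
    (classify : ∀ w → 1 ≤ w → w ≤ n → ∃ λ i → 1 ≤ i × i ≤ c × Q i w)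
    (disjoint : ∀ i j k → 1 ≤ i → i ≤ c → 1 ≤ j → j ≤ c → Q i k → Q j k → i ≡ j) where

    module Class (i : ℕ) (1≤i : 1 ≤ i) (i≤c : i ≤ c) =
      WeightClass (Q i) (τ-closed i 1≤i i≤c) (connected i 1≤i i≤c) (positive i 1≤i i≤c)

    orbit : ∀ i → 1 ≤ i → i ≤ c → IsOrbit adj (InUT adj (Q i))
    orbit i 1≤i i≤c = Class.isOrbit i 1≤i i≤c (representative i 1≤i i≤c)

    covers : ∀ u → u ≢ zeroV → ∃ λ i → 1 ≤ i × i ≤ c × InUT adj (Q i) u
    covers u u≢0 with fromΔ-surjective u
    ... | D , refl with classify (weight D) (1≤weight-preimage _ u≢0 D refl) (weight≤length D)
    ...   | i , 1≤i , i≤c , q = i , 1≤i , i≤c , fromΔ∈InUT (Q i) D q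

    number-of-orbits : NumOrbits adj (suc c)
    number-of-orbits = (λ x → fromΔ P (ones n (weight-of x))) , distinct , cover
      where
      in-range : (x : Fin c) → 1 ≤ suc (toℕ x) × suc (toℕ x) ≤ c
      in-range x = s≤s z≤n , toℕ<n x
      class-weight : (x : Fin c) → ∃ λ k → Q (suc (toℕ x)) k × k ≤ n
      class-weight x = representative (suc (toℕ x)) (proj₁ (in-range x)) (proj₂ (in-range x))
      weight-of : Fin (suc c) → ℕ
      weight-of zero = 0
      weight-of (suc x) = proj₁ (class-weight x)
      ones-weight : ∀ x → weight (ones n (weight-of x)) ≡ weight-of x
      ones-weight zero = weight-ones n 0 z≤n
      ones-weight (suc x) = weight-ones n _ (proj₂ (proj₂ (class-weight x)))
      in-class : ∀ x → Q (suc (toℕ x)) (weight (ones n (weight-of (suc x))))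
      in-class x = subst (Q (suc (toℕ x))) (sym (ones-weight (suc x))) (proj₁ (proj₂ (class-weight x)))
      distinct : ∀ x y → SameOrbit adj (fromΔ P (ones n (weight-of x))) (fromΔ P (ones n (weight-of y))) → x ≡ y
      distinct x y x~y with x | y | ∼-from-SameOrbit x~y
      ... | zero | zero | _ = refl
      ... | zero | suc y′ | x∼y with () ← ℕₚ.<-irrefl
              (sym (trans (sym (ones-weight (suc y′))) (∼-preserves (_≡ 0) ≡0-τ-closed x∼y (ones-weight zero))))
              (positive _ (proj₁ (in-range y′)) (proj₂ (in-range y′)) _ (proj₁ (proj₂ (class-weight y′))))
      ... | suc x′ | y′ | x∼y = same-class y′ (Class.∼-Q (suc (toℕ x′)) (proj₁ (in-range x′)) (proj₂ (in-range x′)) x∼y (in-class x′))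
        where
        same-class : ∀ y′ → Q (suc (toℕ x′)) (weight (ones n (weight-of y′))) → suc x′ ≡ y′
        same-class zero q with () ← ℕₚ.<-irrefl (sym (ones-weight zero)) (positive _ (proj₁ (in-range x′)) (proj₂ (in-range x′)) _ q)
        same-class (suc y′) q = cong suc (toℕ-injective (ℕₚ.suc-injective
          (disjoint _ _ _ (proj₁ (in-range x′)) (proj₂ (in-range x′)) (proj₁ (in-range y′)) (proj₂ (in-range y′)) q (in-class y′))))
      cover : ∀ u → ∃ λ x → SameOrbit adj u (fromΔ P (ones n (weight-of x)))
      cover u with fromΔ-surjective u
      ... | D , refl with weight D in w
      ...   | zero = zero , ∼⇒SameOrbit (same-weight⇒∼ D (ones n 0) (trans w (sym (ones-weight zero))))
      ...   | suc _ with classify (weight D) (subst (1 ≤_) (sym w) (s≤s z≤n)) (weight≤length D)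
      ...     | suc i , 1≤i , i<c , q = suc (fromℕ< i<c) , ∼⇒SameOrbit
                  (connected (suc i) 1≤i i<c D _ q (subst (λ t → Q (suc t) (weight (ones n (weight-of (suc (fromℕ< i<c)))))) (toℕ-fromℕ< i<c) (in-class (fromℕ< i<c))))

    meets-I : ℕ → Set
    meets-I i = ∃ λ k → Q i k × InI adj k

    meets-I? : ∀ i → Dec (meets-I i)
    meets-I? i = ∃-below? (λ k → Q i k × InI adj k) (λ k → Q? i k ×-dec InI? k) (suc n)
                          (λ k (_ , _ , k≤n , _) → s≤s k≤n)

    class-without-I : ∀ i → 1 ≤ i → i ≤ c → ¬ meets-I i → ∃ λ u → OrbitWeight adj u 2
    class-without-I i 1≤i i≤c ∌I with representative i 1≤i i≤c
    ... | k , q , k≤n = fromΔ P (ones n k) ,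
      Class.weight-2 i 1≤i i≤c (ones n k) (subst (Q i) (sym (weight-ones n k k≤n)) q) (λ k′ q′ k′∈I → ∌I (k′ , q′ , k′∈I))

    M≡1⇒all-meet-I : IsMaxWeight adj 1 → ∀ i → 1 ≤ i → i ≤ c → meets-I i
    M≡1⇒all-meet-I M≡1 i 1≤i i≤c with meets-I? i
    ... | yes meets = meets
    ... | no ∌I = ⊥-elim (M≢1 (class-without-I i 1≤i i≤c ∌I) M≡1)

    all-meet-I⇒M≡1 : (∀ i → 1 ≤ i → i ≤ c → meets-I i) → IsMaxWeight adj 1
    all-meet-I⇒M≡1 all-meet = M≡1 λ D 1≤w → reach D (classify (weight D) 1≤w (weight≤length D))
      where
      reach : ∀ D → (∃ λ i → 1 ≤ i × i ≤ c × Q i (weight D)) → ∃ λ v → SameOrbit adj (fromΔ P D) v × weight v ≡ 1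
      reach D (i , 1≤i , i≤c , q) = proj₁ (Class.weight-1 i 1≤i i≤c D q (all-meet i 1≤i i≤c))

    M≤2 : ∃ λ k → IsMaxWeight adj k × k ≤ 2
    M≤2 with ∀-between? meets-I meets-I? c
    ... | inj₁ all-meet = 1 , all-meet-I⇒M≡1 all-meet , s≤s z≤n
    ... | inj₂ (i , 1≤i , i≤c , ∌I) = 2 , (class-without-I i 1≤i i≤c ∌I , orbit-weight≤2) , ℕₚ.≤-refl

  odd-dot⇒odd-countIn : ∀ D → dot D P ≡ true → isOdd (countIn D P) ≡ true
  odd-dot⇒odd-countIn D odd = trans (sym (dot≡isOdd-countIn D P)) odd

  isOdd-weight : ∀ D → dot D P ≡ true → isOdd (weight D) ≡ not (isOdd (countOut D P))
  isOdd-weight D odd = trans (cong isOdd (weight≡countIn+countOut D P))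
    (trans (isOdd-+ (countIn D P) (countOut D P)) (cong (_xor isOdd (countOut D P)) (odd-dot⇒odd-countIn D odd)))

  weight-P+complement : weight P + weight (complement P) ≡ n
  weight-P+complement = weight+weight-complement P

  -- |Π₁| = 1: τ sends weight w to n + 1 - w.

  module Π₁≡1 (size≡1 : sizeΠ₁ adj ≡ 1) where

    c : ℕ
    c = ⌈ n /2⌉

    Q : ℕ → ℕ → Set
    Q i k = k ≡ i ⊎ k ≡ suc m + 1 ∸ i

    n+1≡ : suc m + 1 ≡ suc n
    n+1≡ = ℕₚ.+-comm (suc m) 1

    weight-P : weight P ≡ 1
    weight-P = trans (sym sizeΠ₁≡weight) size≡1

    weight-complement-P : weight (complement P) ≡ m
    weight-complement-P = ℕₚ.suc-injective (trans (cong (_+ weight (complement P)) (sym weight-P)) weight-P+complement)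

    weight-τ+weight : ∀ D → dot D P ≡ true → weight (τ P D) + weight D ≡ suc m + 1
    weight-τ+weight D odd = begin
      weight (τ P D) + weight D                          ≡⟨ cong (weight (τ P D) +_) (weight≡countIn+countOut D P) ⟩
      weight (τ P D) + (countIn D P + countOut D P)      ≡⟨ cong (λ a → weight (τ P D) + (a + countOut D P)) countIn≡1 ⟩
      weight (τ P D) + suc (countOut D P)                ≡⟨ ℕₚ.+-suc _ _ ⟩
      suc (weight (τ P D) + countOut D P)                ≡⟨ cong suc (weight-τ P D odd) ⟩
      suc (countIn D P + weight (complement P))          ≡⟨ cong suc (cong₂ _+_ countIn≡1 weight-complement-P) ⟩
      suc n                                              ≡⟨ sym n+1≡ ⟩
      suc m + 1 ∎
      where
      open ≡-Reasoning
      countIn≡1 : countIn D P ≡ 1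
      countIn≡1 = odd-≤1 (countIn D P) (subst (countIn D P ≤_) weight-P (countIn≤weight D P)) (odd-dot⇒odd-countIn D odd)
        where
        odd-≤1 : ∀ a → a ≤ 1 → isOdd a ≡ true → a ≡ 1
        odd-≤1 (suc zero) _ _ = refl
        odd-≤1 (suc (suc _)) (s≤s ()) _

    ≤n+1 : ∀ {i} → i ≤ c → i ≤ suc m + 1
    ≤n+1 i≤c = ℕₚ.≤-trans i≤c (ℕₚ.≤-trans (ℕₚ.⌈n/2⌉≤n n) (ℕₚ.m≤m+n n 1))

    τ-closed : ∀ i → 1 ≤ i → i ≤ c → ∀ D → dot D P ≡ true → Q i (weight D) → Q i (weight (τ P D))
    τ-closed i _ i≤c D odd (inj₁ refl) = inj₂ (+≡⇒≡∸ (weight-τ+weight D odd))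
    τ-closed i _ i≤c D odd (inj₂ w≡) =
      inj₁ (trans (+≡⇒≡∸ (weight-τ+weight D odd)) (trans (cong (suc m + 1 ∸_) w≡) (ℕₚ.m∸[m∸n]≡n (≤n+1 i≤c))))

    connected : ∀ i → 1 ≤ i → i ≤ c → ∀ D E → Q i (weight D) → Q i (weight E) → D ∼ E
    connected i 1≤i i≤c with τ-link 1 (i ∸ 1) (ℕₚ.≤-reflexive (sym weight-P))
                                   (subst (i ∸ 1 ≤_) (sym weight-complement-P) (ℕₚ.∸-monoˡ-≤ 1 (ℕₚ.≤-trans i≤c (ℕₚ.⌈n/2⌉≤n n)))) refl
    ... | X , weight-X , _ , odd = linked-weights-∼ X weight-X′ (+≡⇒≡∸ (subst (λ t → weight (τ P X) + t ≡ _) weight-X′ (weight-τ+weight X odd)))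
      where
      weight-X′ : weight X ≡ i
      weight-X′ = trans weight-X (ℕₚ.m+[n∸m]≡n 1≤i)

    positive : ∀ i → 1 ≤ i → i ≤ c → ∀ k → Q i k → 1 ≤ k
    positive i 1≤i i≤c k (inj₁ refl) = 1≤i
    positive i 1≤i i≤c k (inj₂ refl) = ℕₚ.m<n⇒0<n∸m (ℕₚ.≤-trans (s≤s (ℕₚ.≤-trans i≤c (ℕₚ.⌈n/2⌉≤n n))) (ℕₚ.≤-reflexive (sym n+1≡)))

    representative : ∀ i → 1 ≤ i → i ≤ c → ∃ λ k → Q i k × k ≤ n
    representative i _ i≤c = i , inj₁ refl , ℕₚ.≤-trans i≤c (ℕₚ.⌈n/2⌉≤n n)

    classify : ∀ w → 1 ≤ w → w ≤ n → ∃ λ i → 1 ≤ i × i ≤ c × Q i w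
    classify w 1≤w w≤n with w ℕₚ.≤? c
    ... | yes w≤c = w , 1≤w , w≤c , inj₁ refl
    ... | no w≰c = suc m + 1 ∸ w , ℕₚ.m<n⇒0<n∸m (ℕₚ.≤-trans (s≤s w≤n) (ℕₚ.≤-reflexive (sym n+1≡))) , ≤c ,
                   inj₂ (sym (ℕₚ.m∸[m∸n]≡n (ℕₚ.≤-trans w≤n (ℕₚ.m≤m+n n 1))))
      where
      ≤c : suc m + 1 ∸ w ≤ c
      ≤c = begin
        suc m + 1 ∸ w        ≤⟨ ℕₚ.∸-monoʳ-≤ (suc m + 1) (ℕₚ.≰⇒> w≰c) ⟩
        suc m + 1 ∸ suc c    ≡⟨ cong (_∸ suc c) n+1≡ ⟩
        n ∸ c                ≡⟨ sym (+≡⇒≡∸ (ℕₚ.⌊n/2⌋+⌈n/2⌉≡n n)) ⟩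
        ⌊ n /2⌋              ≤⟨ ℕₚ.⌊n/2⌋≤⌈n/2⌉ n ⟩
        c ∎
        where open ℕₚ.≤-Reasoning

    complementary : ∀ {i j} → i ≤ c → j ≤ c → i + j ≡ suc m + 1 → i ≡ j
    complementary {i} {j} i≤c j≤c i+j≡ =
      trans (ℕₚ.≤-antisym i≤c (c≤ i j i+j≡ j≤c)) (sym (ℕₚ.≤-antisym j≤c (c≤ j i (trans (ℕₚ.+-comm j i) i+j≡) i≤c)))
      where
      c+c≤ : c + c ≤ suc m + 1
      c+c≤ = begin
        c + c              ≤⟨ ℕₚ.+-monoʳ-≤ c (ℕₚ.⌊n/2⌋-mono (ℕₚ.n≤1+n (suc n))) ⟩
        c + suc ⌊ n /2⌋    ≡⟨ ℕₚ.+-suc c ⌊ n /2⌋ ⟩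
        suc (c + ⌊ n /2⌋)  ≡⟨ cong suc (trans (ℕₚ.+-comm c ⌊ n /2⌋) (ℕₚ.⌊n/2⌋+⌈n/2⌉≡n n)) ⟩
        suc n              ≡⟨ sym n+1≡ ⟩
        suc m + 1 ∎
        where open ℕₚ.≤-Reasoning
      c≤ : ∀ a b → a + b ≡ suc m + 1 → b ≤ c → c ≤ a
      c≤ a b a+b≡ b≤c = ℕₚ.+-cancelʳ-≤ c c a
        (ℕₚ.≤-trans c+c≤ (ℕₚ.≤-trans (ℕₚ.≤-reflexive (sym a+b≡)) (ℕₚ.+-monoʳ-≤ a b≤c)))

    disjoint : ∀ i j k → 1 ≤ i → i ≤ c → 1 ≤ j → j ≤ c → Q i k → Q j k → i ≡ j
    disjoint i j k _ i≤c _ j≤c (inj₁ refl) (inj₁ refl) = refl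
    disjoint i j k _ i≤c _ j≤c (inj₂ refl) (inj₂ k≡) = ℕₚ.∸-cancelˡ-≡ (≤n+1 i≤c) (≤n+1 j≤c) k≡
    disjoint i j k _ i≤c _ j≤c (inj₁ refl) (inj₂ i≡) =
      complementary i≤c j≤c (trans (cong (_+ j) i≡) (ℕₚ.m∸n+n≡m (≤n+1 j≤c)))
    disjoint i j k _ i≤c _ j≤c (inj₂ refl) (inj₁ k≡j) =
      sym (complementary j≤c i≤c (trans (cong (_+ i) (sym k≡j)) (ℕₚ.m∸n+n≡m (≤n+1 i≤c))))

    Q? : ∀ i k → Dec (Q i k)
    Q? i k = (k ℕₚ.≟ i) ⊎-dec (k ℕₚ.≟ suc m + 1 ∸ i)

    open Partition c Q Q? τ-closed connected positive representative classify disjoint public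

    orbit-count : NumOrbits adj ⌈ (suc m + 2) /2⌉
    orbit-count = subst (NumOrbits adj) (cong ⌈_/2⌉ (ℕₚ.+-comm 2 (suc m))) number-of-orbits

    M≡1⇒condition : IsMaxWeight adj 1 → ∀ i → 1 ≤ i → i ≤ c → InI adj i ⊎ InI adj (suc m + 1 ∸ i)
    M≡1⇒condition M≡1 i 1≤i i≤c = ∃-≡⊎≡⇒⊎ (M≡1⇒all-meet-I M≡1 i 1≤i i≤c)

    condition⇒M≡1 : (∀ i → 1 ≤ i → i ≤ c → InI adj i ⊎ InI adj (suc m + 1 ∸ i)) → IsMaxWeight adj 1
    condition⇒M≡1 condition = all-meet-I⇒M≡1 (λ i 1≤i i≤c → ⊎⇒∃-≡⊎≡ (condition i 1≤i i≤c))

  module Π₁≡n-2 (size≡n-2 : sizeΠ₁ adj ≡ suc m ∸ 2) where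

    weight-complement-P : weight (complement P) ≡ 2
    weight-complement-P = from-size m (trans (sym sizeΠ₁≡weight) size≡n-2) weight-P+complement P-odd
      where
      from-size : ∀ m′ → weight P ≡ m′ ∸ 1 → weight P + weight (complement P) ≡ suc m′ → isOdd (weight P) ≡ true →
        weight (complement P) ≡ 2
      from-size zero e _ odd with () ← trans (sym odd) (cong isOdd e)
      from-size (suc zero) e _ odd with () ← trans (sym odd) (cong isOdd e)
      from-size (suc (suc m′)) e sum _ =
        ℕₚ.+-cancelˡ-≡ (suc m′) _ _ (trans (cong (_+ weight (complement P)) (sym e)) (trans sum (ℕₚ.+-comm 2 (suc m′))))

    n≡weight-P+2 : n ≡ weight P + 2
    n≡weight-P+2 = trans (sym weight-P+complement) (cong (weight P +_) weight-complement-P)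

    n-odd : isOdd n ≡ true
    n-odd = trans (cong isOdd n≡weight-P+2) (trans (isOdd-+ (weight P) 2) (trans (xor-identityʳ (isOdd (weight P))) P-odd))

    ⌊n/2⌋≡⌊m/2⌋ : ⌊ n /2⌋ ≡ ⌊ m /2⌋
    ⌊n/2⌋≡⌊m/2⌋ with isOdd⇒odd-form n n-odd
    ... | t , n≡ = trans (cong ⌊_/2⌋ n≡) (trans (half-odd t) (trans (ℕₚ.n≡⌊n+n/2⌋ t) (cong ⌊_/2⌋ (ℕₚ.suc-injective (sym n≡)))))
      where
      half-odd : ∀ t → ⌊ suc (t + t) /2⌋ ≡ t
      half-odd zero = refl
      half-odd (suc t) = cong suc (trans (cong ⌊_/2⌋ (ℕₚ.+-suc t t)) (half-odd t))

    -- With |∁Π₁| = 2 even, τ preserves the parity of the weight.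
    isOdd-weight-τ : ∀ D → dot D P ≡ true → isOdd (weight (τ P D)) ≡ isOdd (weight D)
    isOdd-weight-τ D odd = begin
      isOdd (weight (τ P D))                           ≡⟨ sym (xor-cancelʳ (isOdd (weight (τ P D))) b) ⟩
      (isOdd (weight (τ P D)) xor b) xor b             ≡⟨ cong (_xor b) (sym (isOdd-+ (weight (τ P D)) (countOut D P))) ⟩
      isOdd (weight (τ P D) + countOut D P) xor b      ≡⟨ cong (λ x → isOdd x xor b) (weight-τ P D odd) ⟩
      isOdd (countIn D P + weight (complement P)) xor b ≡⟨ cong (λ x → isOdd (countIn D P + x) xor b) weight-complement-P ⟩
      isOdd (countIn D P + 2) xor b                    ≡⟨ cong (_xor b) (trans (isOdd-+ (countIn D P) 2) (xor-identityʳ (isOdd (countIn D P)))) ⟩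
      isOdd (countIn D P) xor b                        ≡⟨ sym (isOdd-+ (countIn D P) (countOut D P)) ⟩
      isOdd (countIn D P + countOut D P)               ≡⟨ cong isOdd (sym (weight≡countIn+countOut D P)) ⟩
      isOdd (weight D) ∎
      where
      open ≡-Reasoning
      b = isOdd (countOut D P)

    c : ℕ
    c = suc ⌊ m /2⌋

    Q : ℕ → ℕ → Set
    Q zero _ = ⊥
    Q (suc zero) k = Odd k × 1 ≤ k × k ≤ suc m
    Q (suc (suc j)) k = k ≡ 2 * suc j

    Q? : ∀ i k → Dec (Q i k)
    Q? zero k = no λ ()
    Q? (suc zero) k = (k ℕ.% 2 ℕₚ.≟ 1) ×-dec (1 ℕₚ.≤? k) ×-dec (k ℕₚ.≤? suc m)
    Q? (suc (suc j)) k = k ℕₚ.≟ 2 * suc j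

    τ-closed : ∀ i → 1 ≤ i → i ≤ c → ∀ D → dot D P ≡ true → Q i (weight D) → Q i (weight (τ P D))
    τ-closed zero () _
    τ-closed (suc zero) _ _ D odd (w-odd , 1≤w , _) =
      isOdd⇒Odd (weight (τ P D)) (trans (isOdd-weight-τ D odd) (Odd⇒isOdd (weight D) w-odd)) , 1≤weight-τ D odd 1≤w , weight≤length (τ P D)
    τ-closed (suc (suc j)) _ _ D odd w≡ = trans weight-τD≡weight-D w≡
      where
      countOut-odd : isOdd (countOut D P) ≡ true
      countOut-odd = Boolₚ.not-injective (trans (sym (isOdd-weight D odd)) (trans (cong isOdd w≡) (isOdd-2* (suc j))))
      countOut≡1 : countOut D P ≡ 1
      countOut≡1 = odd-≤2 (countOut D P) (subst (countOut D P ≤_) weight-complement-P (countOut≤weight D P)) countOut-odd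
        where
        odd-≤2 : ∀ a → a ≤ 2 → isOdd a ≡ true → a ≡ 1
        odd-≤2 (suc zero) _ _ = refl
        odd-≤2 (suc (suc zero)) _ ()
        odd-≤2 (suc (suc (suc _))) (s≤s (s≤s ())) _
      weight-τD≡weight-D : weight (τ P D) ≡ weight D
      weight-τD≡weight-D = ℕₚ.+-cancelʳ-≡ 1 _ _ (begin
        weight (τ P D) + 1                            ≡⟨ cong (weight (τ P D) +_) (sym countOut≡1) ⟩
        weight (τ P D) + countOut D P                 ≡⟨ weight-τ P D odd ⟩
        countIn D P + weight (complement P)           ≡⟨ cong (countIn D P +_) weight-complement-P ⟩
        countIn D P + 2                               ≡⟨ sym (ℕₚ.+-assoc (countIn D P) 1 1) ⟩
        countIn D P + 1 + 1                           ≡⟨ cong (λ x → countIn D P + x + 1) (sym countOut≡1) ⟩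
        countIn D P + countOut D P + 1                ≡⟨ cong (_+ 1) (sym (weight≡countIn+countOut D P)) ⟩
        weight D + 1 ∎)
        where open ≡-Reasoning

    +2 : ∀ t → suc (suc t + suc t) ≡ suc (t + t) + 2
    +2 t = cong suc (trans (ℕₚ.+-suc (suc t) t) (ℕₚ.+-comm 2 (t + t)))

    -- Every odd weight is joined to weight 1, two units at a time.
    odd-∼-one : ∀ t D → weight D ≡ suc (t + t) → D ∼ ones n 1
    odd-∼-one zero D w≡ = same-weight⇒∼ D (ones n 1) (trans w≡ (sym (weight-ones n 1 (s≤s z≤n))))
    odd-∼-one (suc t) D w≡ = via (τ-link (suc (t + t)) 0 ≤weight-P z≤n (cong not (isOdd-double t)))
      where
      ≤weight-P : suc (t + t) ≤ weight P
      ≤weight-P = ℕₚ.+-cancelʳ-≤ 2 _ _ (subst₂ _≤_ (trans w≡ (+2 t)) n≡weight-P+2 (weight≤length D))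
      via : (∃ λ X → weight X ≡ suc (t + t) + 0 × weight (τ P X) + 0 ≡ suc (t + t) + weight (complement P) × dot X P ≡ true) →
        D ∼ ones n 1
      via (X , weight-X , weight-τX , _) =
        ∼-trans (same-weight⇒∼ D (τ P X) (trans w≡ (sym weight-τX′))) (∼-trans (∼-sym (τ-step X)) (odd-∼-one t X weight-X′))
        where
        weight-X′ : weight X ≡ suc (t + t)
        weight-X′ = trans weight-X (ℕₚ.+-identityʳ _)
        weight-τX′ : weight (τ P X) ≡ suc (suc t + suc t)
        weight-τX′ = trans (sym (ℕₚ.+-identityʳ _)) (trans weight-τX (trans (cong (suc (t + t) +_) weight-complement-P) (sym (+2 t))))

    connected : ∀ i → 1 ≤ i → i ≤ c → ∀ D E → Q i (weight D) → Q i (weight E) → D ∼ E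
    connected (suc zero) _ _ D E (odd-D , _) (odd-E , _)
      with isOdd⇒odd-form (weight D) (Odd⇒isOdd (weight D) odd-D) | isOdd⇒odd-form (weight E) (Odd⇒isOdd (weight E) odd-E)
    ... | t , D≡ | t′ , E≡ = ∼-trans (odd-∼-one t D D≡) (∼-sym (odd-∼-one t′ E E≡))
    connected (suc (suc j)) _ _ D E D≡ E≡ = same-weight⇒∼ D E (trans D≡ (sym E≡))

    positive : ∀ i → 1 ≤ i → i ≤ c → ∀ k → Q i k → 1 ≤ k
    positive (suc zero) _ _ k (_ , 1≤k , _) = 1≤k
    positive (suc (suc j)) _ _ k refl = s≤s z≤n

    double≤ : ∀ {t k} → t ≤ ⌊ k /2⌋ → 2 * t ≤ k
    double≤ {t} {k} t≤ = begin
      2 * t                  ≡⟨ cong (t +_) (ℕₚ.+-identityʳ t) ⟩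
      t + t                  ≤⟨ ℕₚ.+-mono-≤ t≤ (ℕₚ.≤-trans t≤ (ℕₚ.⌊n/2⌋≤⌈n/2⌉ k)) ⟩
      ⌊ k /2⌋ + ⌈ k /2⌉      ≡⟨ ℕₚ.⌊n/2⌋+⌈n/2⌉≡n k ⟩
      k ∎
      where open ℕₚ.≤-Reasoning

    representative : ∀ i → 1 ≤ i → i ≤ c → ∃ λ k → Q i k × k ≤ n
    representative (suc zero) _ _ = 1 , (refl , s≤s z≤n , s≤s z≤n) , s≤s z≤n
    representative (suc (suc j)) _ (s≤s j<) = 2 * suc j , refl , ℕₚ.m≤n⇒m≤1+n (double≤ j<)

    classify : ∀ w → 1 ≤ w → w ≤ n → ∃ λ i → 1 ≤ i × i ≤ c × Q i w
    classify w 1≤w w≤n with isOdd w in odd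
    ... | true = 1 , s≤s z≤n , s≤s z≤n , isOdd⇒Odd w odd , 1≤w , w≤n
    ... | false with ¬isOdd⇒even-form w odd
    ...   | zero , refl = ⊥-elim (ℕₚ.n≮0 1≤w)
    ...   | suc t , refl = suc (suc t) , s≤s z≤n , s≤s t< , cong (suc t +_) (sym (ℕₚ.+-identityʳ (suc t)))
      where
      w≤m : suc t + suc t ≤ m
      w≤m = ℕₚ.≤-pred (ℕₚ.≤∧≢⇒< w≤n λ w≡n → odd≢double (suc t) n n-odd (sym w≡n))
      t< : suc t ≤ ⌊ m /2⌋
      t< = subst (_≤ ⌊ m /2⌋) (sym (ℕₚ.n≡⌊n+n/2⌋ (suc t))) (ℕₚ.⌊n/2⌋-mono w≤m)

    disjoint : ∀ i j k → 1 ≤ i → i ≤ c → 1 ≤ j → j ≤ c → Q i k → Q j k → i ≡ j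
    disjoint (suc zero) (suc zero) k _ _ _ _ _ _ = refl
    disjoint (suc zero) (suc (suc j)) k _ _ _ _ (odd , _) refl with () ← trans (sym (Odd⇒isOdd k odd)) (isOdd-2* (suc j))
    disjoint (suc (suc i)) (suc zero) k _ _ _ _ refl (odd , _) with () ← trans (sym (Odd⇒isOdd k odd)) (isOdd-2* (suc i))
    disjoint (suc (suc i)) (suc (suc j)) k _ _ _ _ refl k≡ = cong suc (ℕₚ.*-cancelˡ-≡ (suc i) (suc j) 2 k≡)

    open Partition c Q Q? τ-closed connected positive representative classify disjoint public

    odd-orbit : IsOrbit adj (InUT adj (λ k → Odd k × 1 ≤ k × k ≤ suc m))
    odd-orbit = orbit 1 (s≤s z≤n) (s≤s z≤n)

    even-orbit : ∀ j → 1 ≤ j → j ≤ ⌊ (suc m ∸ 1) /2⌋ → IsOrbit adj (InUT adj (λ k → k ≡ 2 * j))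
    even-orbit (suc j) _ j≤ = orbit (suc (suc j)) (s≤s z≤n) (s≤s j≤)

    odd-or-even : ∀ u → u ≢ zeroV →
      InUT adj (λ k → Odd k × 1 ≤ k × k ≤ suc m) u ⊎
      (∃ λ j → 1 ≤ j × j ≤ ⌊ (suc m ∸ 1) /2⌋ × InUT adj (λ k → k ≡ 2 * j) u)
    odd-or-even u u≢0 with covers u u≢0
    ... | suc zero , _ , _ , u∈ = inj₁ u∈
    ... | suc (suc j) , _ , s≤s j≤ , u∈ = inj₂ (suc j , s≤s z≤n , j≤ , u∈)

    orbit-count : NumOrbits adj ⌊ (suc m + 3) /2⌋
    orbit-count = subst (NumOrbits adj) (cong ⌊_/2⌋ (ℕₚ.+-comm 3 (suc m))) number-of-orbits

    M≡1⇒condition : IsMaxWeight adj 1 →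
      (∃ λ i → (Odd i × 1 ≤ i × i ≤ suc m) × InI adj i) × (∀ j → 1 ≤ j → j ≤ ⌊ suc m /2⌋ → InI adj (2 * j))
    M≡1⇒condition M≡1 = M≡1⇒all-meet-I M≡1 1 (s≤s z≤n) (s≤s z≤n) , even
      where
      even : ∀ j → 1 ≤ j → j ≤ ⌊ suc m /2⌋ → InI adj (2 * j)
      even (suc j) _ j≤ with M≡1⇒all-meet-I M≡1 (suc (suc j)) (s≤s z≤n) (s≤s (subst (suc j ≤_) ⌊n/2⌋≡⌊m/2⌋ j≤))
      ... | k , refl , k∈I = k∈I

    condition⇒M≡1 : (∃ λ i → (Odd i × 1 ≤ i × i ≤ suc m) × InI adj i) →
      (∀ j → 1 ≤ j → j ≤ ⌊ suc m /2⌋ → InI adj (2 * j)) → IsMaxWeight adj 1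
    condition⇒M≡1 odd-meets even-in-I = all-meet-I⇒M≡1 meets
      where
      meets : ∀ i → 1 ≤ i → i ≤ c → meets-I i
      meets (suc zero) _ _ = odd-meets
      meets (suc (suc j)) _ (s≤s j≤) = 2 * suc j , refl , even-in-I (suc j) (s≤s z≤n) (subst (suc j ≤_) (sym ⌊n/2⌋≡⌊m/2⌋) j≤)

  -- |Π₁| = n - 1: τ exchanges the weights 2i - 1 and 2i.

  module Π₁≡n-1 (size≡n-1 : sizeΠ₁ adj ≡ suc m ∸ 1) where

    weight-P : weight P ≡ m
    weight-P = trans (sym sizeΠ₁≡weight) size≡n-1

    weight-complement-P : weight (complement P) ≡ 1
    weight-complement-P = ℕₚ.+-cancelˡ-≡ m _ _ (trans (cong (_+ weight (complement P)) (sym weight-P))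
                                                       (trans weight-P+complement (ℕₚ.+-comm 1 m)))

    n-even : isOdd n ≡ false
    n-even = begin
      isOdd n                                             ≡⟨ cong isOdd (sym weight-P+complement) ⟩
      isOdd (weight P + weight (complement P))            ≡⟨ isOdd-+ (weight P) (weight (complement P)) ⟩
      isOdd (weight P) xor isOdd (weight (complement P))  ≡⟨ cong₂ (λ x y → x xor isOdd y) P-odd weight-complement-P ⟩
      false ∎
      where open ≡-Reasoning

    half : ℕ
    half = proj₁ (¬isOdd⇒even-form n n-even)

    n≡half+half : n ≡ half + half
    n≡half+half = proj₂ (¬isOdd⇒even-form n n-even)

    c : ℕ
    c = ⌈ n /2⌉

    c≡half : c ≡ half
    c≡half = trans (cong ⌈_/2⌉ n≡half+half) (sym (ℕₚ.n≡⌈n+n/2⌉ half))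

    Q : ℕ → ℕ → Set
    Q i k = k ≡ 2 * i ∸ 1 ⊎ k ≡ 2 * i

    2*suc : ∀ i → 2 * suc i ≡ suc (suc (i + i))
    2*suc i = trans (cong suc (ℕₚ.+-suc i (i + 0))) (cong (λ x → suc (suc (i + x))) (ℕₚ.+-identityʳ i))

    -- {2i - 1, 2i} without truncated subtraction
    Q-pair : ∀ i k → Q (suc i) k → k ≡ suc (i + i) ⊎ k ≡ suc (suc (i + i))
    Q-pair i k (inj₁ k≡) = inj₁ (trans k≡ (cong (_∸ 1) (2*suc i)))
    Q-pair i k (inj₂ k≡) = inj₂ (trans k≡ (2*suc i))

    pair-Q : ∀ i k → k ≡ suc (i + i) ⊎ k ≡ suc (suc (i + i)) → Q (suc i) k
    pair-Q i k (inj₁ k≡) = inj₁ (trans k≡ (sym (cong (_∸ 1) (2*suc i))))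
    pair-Q i k (inj₂ k≡) = inj₂ (trans k≡ (sym (2*suc i)))

    weight-τ-shift : ∀ D → dot D P ≡ true →
      (isOdd (weight D) ≡ true × weight (τ P D) ≡ suc (weight D)) ⊎ (isOdd (weight D) ≡ false × suc (weight (τ P D)) ≡ weight D)
    weight-τ-shift D odd with countOut D P | countOut≤weight D P | weight≡countIn+countOut D P | weight-τ P D odd
                            | isOdd-weight D odd
    ... | zero | _ | w≡ | τ≡ | parity =
      inj₁ (parity , trans (sym (ℕₚ.+-identityʳ (weight (τ P D)))) (trans τ≡ (trans (cong (countIn D P +_) weight-complement-P)
                                (trans (ℕₚ.+-comm (countIn D P) 1) (cong suc (trans (sym (ℕₚ.+-identityʳ _)) (sym w≡)))))))
    ... | suc zero | _ | w≡ | τ≡ | parity =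
      inj₂ (parity , trans (ℕₚ.+-comm 1 _) (trans τ≡ (trans (cong (countIn D P +_) weight-complement-P) (sym w≡))))
    ... | suc (suc x) | bound | _ | _ | _ with s≤s () ← subst (suc (suc x) ≤_) weight-complement-P bound

    τ-closed : ∀ i → 1 ≤ i → i ≤ c → ∀ D → dot D P ≡ true → Q i (weight D) → Q i (weight (τ P D))
    τ-closed zero () _
    τ-closed (suc i) _ _ D odd q with Q-pair i _ q | weight-τ-shift D odd
    ... | inj₁ w≡ | inj₁ (_ , τ≡) = pair-Q i _ (inj₂ (trans τ≡ (cong suc w≡)))
    ... | inj₂ w≡ | inj₂ (_ , τ≡) = pair-Q i _ (inj₁ (ℕₚ.suc-injective (trans τ≡ w≡)))
    ... | inj₁ w≡ | inj₂ (even , _) with () ← trans (sym even) (trans (cong isOdd w≡) (cong not (isOdd-double i)))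
    ... | inj₂ w≡ | inj₁ (odd′ , _) with () ← trans (sym odd′) (trans (cong isOdd w≡) (trans (Boolₚ.not-involutive (isOdd (i + i))) (isOdd-double i)))

    halve : ∀ {a b} → a + a ≤ b + b → a ≤ b
    halve {a} {b} a+a≤ = subst₂ _≤_ (sym (ℕₚ.n≡⌊n+n/2⌋ a)) (sym (ℕₚ.n≡⌊n+n/2⌋ b)) (ℕₚ.⌊n/2⌋-mono a+a≤)

    double-injective : ∀ {a b} → a + a ≡ b + b → a ≡ b
    double-injective {a} {b} e = trans (ℕₚ.n≡⌊n+n/2⌋ a) (trans (cong ⌊_/2⌋ e) (sym (ℕₚ.n≡⌊n+n/2⌋ b)))

    2*≤n : ∀ {i} → i ≤ c → 2 * i ≤ n
    2*≤n {i} i≤c = begin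
      2 * i          ≡⟨ cong (i +_) (ℕₚ.+-identityʳ i) ⟩
      i + i          ≤⟨ ℕₚ.+-mono-≤ i≤half i≤half ⟩
      half + half    ≡⟨ sym n≡half+half ⟩
      n ∎
      where
      open ℕₚ.≤-Reasoning
      i≤half = subst (i ≤_) c≡half i≤c

    connected : ∀ i → 1 ≤ i → i ≤ c → ∀ D E → Q i (weight D) → Q i (weight E) → D ∼ E
    connected (suc i) _ i≤c D E qD qE = via (τ-link (suc (i + i)) 0 ≤weight-P z≤n (cong not (isOdd-double i)))
      where
      ≤weight-P : suc (i + i) ≤ weight P
      ≤weight-P = subst (suc (i + i) ≤_) (sym weight-P) (ℕₚ.≤-pred (subst (_≤ n) (2*suc i) (2*≤n i≤c)))
      via : (∃ λ X → weight X ≡ suc (i + i) + 0 × weight (τ P X) + 0 ≡ suc (i + i) + weight (complement P) × dot X P ≡ true) →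
        D ∼ E
      via (X , weight-X , weight-τX , _) = linked-weights-∼ X weight-X′ weight-τX′ D E (Q-pair i _ qD) (Q-pair i _ qE)
        where
        weight-X′ : weight X ≡ suc (i + i)
        weight-X′ = trans weight-X (ℕₚ.+-identityʳ _)
        weight-τX′ : weight (τ P X) ≡ suc (suc (i + i))
        weight-τX′ = trans (sym (ℕₚ.+-identityʳ _)) (trans weight-τX (trans (cong (suc (i + i) +_) weight-complement-P)
                                                                            (ℕₚ.+-comm (suc (i + i)) 1)))

    positive : ∀ i → 1 ≤ i → i ≤ c → ∀ k → Q i k → 1 ≤ k
    positive (suc i) _ _ k q with Q-pair i k q
    ... | inj₁ refl = s≤s z≤n
    ... | inj₂ refl = s≤s z≤n

    representative : ∀ i → 1 ≤ i → i ≤ c → ∃ λ k → Q i k × k ≤ n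
    representative i _ i≤c = 2 * i , inj₂ refl , 2*≤n i≤c

    classify : ∀ w → 1 ≤ w → w ≤ n → ∃ λ i → 1 ≤ i × i ≤ c × Q i w
    classify w 1≤w w≤n with isOdd w in parity
    ... | true with isOdd⇒odd-form w parity
    ...   | s , refl = suc s , s≤s z≤n , subst (suc s ≤_) (sym c≡half) (halve 2s+2≤) , pair-Q s _ (inj₁ refl)
      where
      2s+2≤ : suc s + suc s ≤ half + half
      2s+2≤ = subst (_≤ half + half) (sym (cong suc (ℕₚ.+-suc s s)))
                (ℕₚ.≤∧≢⇒< (subst (suc (s + s) ≤_) n≡half+half w≤n) (λ e → odd≢double half (suc (s + s)) parity e))
    classify w 1≤w w≤n | false with ¬isOdd⇒even-form w parity
    ...   | zero , refl = ⊥-elim (ℕₚ.n≮0 1≤w)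
    ...   | suc s , refl = suc s , s≤s z≤n , subst (suc s ≤_) (sym c≡half) (halve (subst (suc s + suc s ≤_) n≡half+half w≤n)) ,
                           pair-Q s _ (inj₂ (cong suc (ℕₚ.+-suc s s)))

    disjoint : ∀ i j k → 1 ≤ i → i ≤ c → 1 ≤ j → j ≤ c → Q i k → Q j k → i ≡ j
    disjoint (suc i) (suc j) k _ _ _ _ qi qj with Q-pair i k qi | Q-pair j k qj
    ... | inj₁ refl | inj₁ e = cong suc (double-injective (ℕₚ.suc-injective e))
    ... | inj₂ refl | inj₂ e = cong suc (double-injective (ℕₚ.suc-injective (ℕₚ.suc-injective e)))
    ... | inj₁ refl | inj₂ e = ⊥-elim (odd≢double i (suc (j + j)) (cong not (isOdd-double j)) (sym (ℕₚ.suc-injective e)))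
    ... | inj₂ refl | inj₁ e = ⊥-elim (odd≢double j (suc (i + i)) (cong not (isOdd-double i)) (ℕₚ.suc-injective e))

    Q? : ∀ i k → Dec (Q i k)
    Q? i k = (k ℕₚ.≟ 2 * i ∸ 1) ⊎-dec (k ℕₚ.≟ 2 * i)

    open Partition c Q Q? τ-closed connected positive representative classify disjoint public

    orbit-count : NumOrbits adj ⌊ (suc m + 2) /2⌋
    orbit-count = subst (NumOrbits adj) (sym count≡) number-of-orbits
      where
      count≡ : ⌊ (suc m + 2) /2⌋ ≡ suc c
      count≡ = trans (cong ⌊_/2⌋ (ℕₚ.+-comm n 2))
                     (cong suc (trans (cong ⌊_/2⌋ n≡half+half) (trans (sym (ℕₚ.n≡⌊n+n/2⌋ half)) (sym c≡half))))

    M≡1⇒condition : IsMaxWeight adj 1 → ∀ i → 1 ≤ i → i ≤ c → InI adj (2 * i ∸ 1) ⊎ InI adj (2 * i)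
    M≡1⇒condition M≡1 i 1≤i i≤c = ∃-≡⊎≡⇒⊎ (M≡1⇒all-meet-I M≡1 i 1≤i i≤c)

    condition⇒M≡1 : (∀ i → 1 ≤ i → i ≤ c → InI adj (2 * i ∸ 1) ⊎ InI adj (2 * i)) → IsMaxWeight adj 1
    condition⇒M≡1 condition = all-meet-I⇒M≡1 (λ i 1≤i i≤c → ⊎⇒∃-≡⊎≡ (condition i 1≤i i≤c))

theorem5p4 :
  ∀ (m : ℕ) (adj : Adj (suc m)) →
  1 ≤ m → IsSimple adj → IsConnected adj → InducedPathPrefix adj →
  Odd (sizeΠ₁ adj) →
  (sizeΠ₁ adj ≡ 1 ⊎ sizeΠ₁ adj ≡ suc m ∸ 2 ⊎ sizeΠ₁ adj ≡ suc m ∸ 1) →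
  (sizeΠ₁ adj ≡ 1 →
    (∀ i → 1 ≤ i → i ≤ ⌈ suc m /2⌉ →
      IsOrbit adj (InUT adj (λ k → k ≡ i ⊎ k ≡ suc m + 1 ∸ i))) ×
    (∀ u → u ≢ zeroV → ∃ λ i → 1 ≤ i × i ≤ ⌈ suc m /2⌉ ×
      InUT adj (λ k → k ≡ i ⊎ k ≡ suc m + 1 ∸ i) u) ×
    NumOrbits adj ⌈ (suc m + 2) /2⌉ ×
    ((IsMaxWeight adj 1 →
        ∀ i → 1 ≤ i → i ≤ ⌈ suc m /2⌉ → InI adj i ⊎ InI adj (suc m + 1 ∸ i)) ×
     ((∀ i → 1 ≤ i → i ≤ ⌈ suc m /2⌉ → InI adj i ⊎ InI adj (suc m + 1 ∸ i)) →
        IsMaxWeight adj 1))) ×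
  (sizeΠ₁ adj ≡ suc m ∸ 2 →
    IsOrbit adj (InUT adj (λ k → Odd k × 1 ≤ k × k ≤ suc m)) ×
    (∀ j → 1 ≤ j → j ≤ ⌊ (suc m ∸ 1) /2⌋ →
      IsOrbit adj (InUT adj (λ k → k ≡ 2 * j))) ×
    (∀ u → u ≢ zeroV →
      InUT adj (λ k → Odd k × 1 ≤ k × k ≤ suc m) u ⊎
      (∃ λ j → 1 ≤ j × j ≤ ⌊ (suc m ∸ 1) /2⌋ × InUT adj (λ k → k ≡ 2 * j) u)) ×
    NumOrbits adj ⌊ (suc m + 3) /2⌋ ×
    ((IsMaxWeight adj 1 →
        (∃ λ i → (Odd i × 1 ≤ i × i ≤ suc m) × InI adj i) ×
        (∀ j → 1 ≤ j → j ≤ ⌊ suc m /2⌋ → InI adj (2 * j))) ×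
     ((∃ λ i → (Odd i × 1 ≤ i × i ≤ suc m) × InI adj i) →
        (∀ j → 1 ≤ j → j ≤ ⌊ suc m /2⌋ → InI adj (2 * j)) →
        IsMaxWeight adj 1))) ×
  (sizeΠ₁ adj ≡ suc m ∸ 1 →
    (∀ i → 1 ≤ i → i ≤ ⌈ suc m /2⌉ →
      IsOrbit adj (InUT adj (λ k → k ≡ 2 * i ∸ 1 ⊎ k ≡ 2 * i))) ×
    (∀ u → u ≢ zeroV → ∃ λ i → 1 ≤ i × i ≤ ⌈ suc m /2⌉ ×
      InUT adj (λ k → k ≡ 2 * i ∸ 1 ⊎ k ≡ 2 * i) u) ×
    NumOrbits adj ⌊ (suc m + 2) /2⌋ ×
    ((IsMaxWeight adj 1 →
        ∀ i → 1 ≤ i → i ≤ ⌈ suc m /2⌉ → InI adj (2 * i ∸ 1) ⊎ InI adj (2 * i)) ×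
     ((∀ i → 1 ≤ i → i ≤ ⌈ suc m /2⌉ → InI adj (2 * i ∸ 1) ⊎ InI adj (2 * i)) →
        IsMaxWeight adj 1))) ×
  (∃ λ k → IsMaxWeight adj k × k ≤ 2)
theorem5p4 m adj _ simple _ path Π₁-odd sizes =
  (λ size≡1 → let open Π₁≡1 size≡1 in orbit , covers , orbit-count , M≡1⇒condition , condition⇒M≡1) ,
  (λ size≡n-2 → let open Π₁≡n-2 size≡n-2 in
     odd-orbit , even-orbit , odd-or-even , orbit-count , M≡1⇒condition , condition⇒M≡1) ,
  (λ size≡n-1 → let open Π₁≡n-1 size≡n-1 in orbit , covers , orbit-count , M≡1⇒condition , condition⇒M≡1) ,
  M≤2-in-each-case sizes
  where
  open OddΠ₁ adj simple path Π₁-odd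
  M≤2-in-each-case : sizeΠ₁ adj ≡ 1 ⊎ sizeΠ₁ adj ≡ suc m ∸ 2 ⊎ sizeΠ₁ adj ≡ suc m ∸ 1 → ∃ λ k → IsMaxWeight adj k × k ≤ 2
  M≤2-in-each-case (inj₁ size≡1) = Π₁≡1.M≤2 size≡1
  M≤2-in-each-case (inj₂ (inj₁ size≡n-2)) = Π₁≡n-2.M≤2 size≡n-2
  M≤2-in-each-case (inj₂ (inj₂ size≡n-1)) = Π₁≡n-1.M≤2 size≡n-1
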